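{- Let $L$ be one of $\mathbf{IL}^-(\mathbf{J4})$, $\mathbf{IL}^-(\mathbf{J1},\mathbf{J4})$, $\mathbf{IL}^-(\mathbf{J4},\mathbf{J5})$, $\mathbf{IL}^-(\mathbf{J1},\mathbf{J4},\mathbf{J5})$, $\mathbf{IL}^-(\mathbf{J2})$, $\mathbf{IL}^-(\mathbf{J2},\mathbf{J4}_+)$. Then for every formula $A$ the following are equivalent: (1) $L\vdash A$; (2) $A$ is valid in every $\mathbf{ILS}$-frame in which all axioms of $L$ are valid; (3) $A$ is valid in every finite $\mathbf{ILS}$-frame in which all axioms of $L$ are valid.
   Context: Formulas are built from countably many propositional variables, $\top,\bot$, $\neg,\land,\lor,\to$, unary $\Box$ and binary $\rhd$; $\Diamond A$ abbreviates $\neg\Box\neg A$. The logic $\mathbf{IL}^-$ has as axioms all tautologies, $\Box(A\to B)\to(\Box A\to\Box B)$, $\Box(\Box A\to A)\to\Box A$, $(A\rhd C)\land(B\rhd C)\to(A\lor B)\rhd C$, and $\Box A\leftrightarrow(\neg A)\rhd\bot$; rules: modus ponens, necessitation, from $A\to B$ infer $C\rhd A\to C\rhd B$, from $A\to B$ infer $B\rhd C\to A\rhd C$. $\mathbf{IL}^-(\Sigma_1,\dots,\Sigma_n)$ is $\mathbf{IL}^-$ with schemata $\Sigma_i$ added as axioms. Schemata: $\mathbf{J1}$: $\Box(A\to B)\to A\rhd B$; $\mathbf{J2}$: $(A\rhd B)\land(B\rhd C)\to A\rhd C$; $\mathbf{J4}$: $A\rhd B\to(\Diamond A\to\Diamond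 B)$; $\mathbf{J4}_+$: $\Box(A\to B)\to(C\rhd A\to C\rhd B)$; $\mathbf{J5}$: $\Diamond A\rhd A$. An $\mathbf{ILS}$-frame is a triple $\langle W,R,\{S_x\}_{x\in W}\rangle$ with $W$ nonempty, $R$ transitive and conversely well-founded on $W$, each $S_x\subseteq W\times(\mathcal P(W)\setminus\{\emptyset\})$ such that $yS_xV$ implies $xRy$, and (monotonicity) $yS_xV$ and $V\subseteq U$ imply $yS_xU$. Satisfaction: usual Boolean clauses, $x\Vdash\Box A$ iff $y\Vdash A$ for all $y$ with $xRy$, and $x\Vdash A\rhd B$ iff for every $y$ with $xRy$ and $y\Vdash A$ there is $V\subseteq W$ with $yS_xV$ and $z\Vdash B$ for all $z\in V$. Validity in a frame: truth at every point under every satisfaction relation (for schemata: all instances). -}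

module Defs where

open import Level using (Level; 0ℓ; Setω)
open import Data.Nat using (ℕ)
open import Data.Fin using (Fin)
open import Data.Bool using (Bool; true; false; not; _∧_; _∨_)
open import Data.Unit using (⊤)
open import Data.Empty using (⊥)
open import Data.Product using (Σ; _×_; ∃)
open import Data.Sum using (_⊎_)
open import Data.List using (List; []; _∷_)
open import Data.List.Membership.Propositional using (_∈_)
open import Relation.Nullary using (¬_)
open import Relation.Binary.PropositionalEquality using (_≡_)
open import Induction.WellFounded using (WellFounded)
open import Function.Bundles using (_↔_)
open import Axiom.ExcludedMiddle using (ExcludedMiddle)

infixr 6 _⊃_
infixr 7 _∨'_
infixr 8 _∧'_
infix  9 _▷_
infix  5 _⇔'_
infix  10 □_ ¬'_ ◇_

data Fm : Set where
  var   : ℕ → Fm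
  ⊤'    : Fm
  ⊥'    : Fm
  ¬'_   : Fm → Fm
  _∧'_  : Fm → Fm → Fm
  _∨'_  : Fm → Fm → Fm
  _⊃_   : Fm → Fm → Fm
  □_    : Fm → Fm
  _▷_   : Fm → Fm → Fm

◇_ : Fm → Fm
◇ A = ¬' (□ (¬' A))

_⇔'_ : Fm → Fm → Fm
A ⇔' B = (A ⊃ B) ∧' (B ⊃ A)

-- Tautologies: formulas true under every classical Boolean valuation
-- that treats variables, □-formulas and ▷-formulas as atoms.

_⇒ᵇ_ : Bool → Bool → Bool
a ⇒ᵇ b = not a ∨ b

evalB : (Fm → Bool) → Fm → Bool
evalB v (var p)  = v (var p)
evalB v ⊤'       = true
evalB v ⊥'       = false
evalB v (¬' A)   = not (evalB v A)
evalB v (A ∧' B) = evalB v A ∧ evalB v B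
evalB v (A ∨' B) = evalB v A ∨ evalB v B
evalB v (A ⊃ B)  = evalB v A ⇒ᵇ evalB v B
evalB v (□ A)    = v (□ A)
evalB v (A ▷ B)  = v (A ▷ B)

Tautology : Fm → Set
Tautology A = (v : Fm → Bool) → evalB v A ≡ true

data Schema : Set where
  J1 J2 J4 J4+ J5 : Schema

data Instance : Schema → Fm → Set where
  j1  : ∀ A B   → Instance J1  (□ (A ⊃ B) ⊃ A ▷ B)
  j2  : ∀ A B C → Instance J2  ((A ▷ B) ∧' (B ▷ C) ⊃ A ▷ C)
  j4  : ∀ A B   → Instance J4  (A ▷ B ⊃ (◇ A ⊃ ◇ B))
  j4+ : ∀ A B C → Instance J4+ (□ (A ⊃ B) ⊃ (C ▷ A ⊃ C ▷ B))
  j5  : ∀ A     → Instance J5  ((◇ A) ▷ A)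

-- The logic IL⁻(Σ₁,…,Σₙ), Σ given as a list of schemata

data Axiom (Λ : List Schema) : Fm → Set where
  taut   : ∀ {A} → Tautology A → Axiom Λ A
  axK    : ∀ A B → Axiom Λ (□ (A ⊃ B) ⊃ (□ A ⊃ □ B))
  axL    : ∀ A   → Axiom Λ (□ (□ A ⊃ A) ⊃ □ A)
  axJ3   : ∀ A B C → Axiom Λ ((A ▷ C) ∧' (B ▷ C) ⊃ (A ∨' B) ▷ C)
  axJ6   : ∀ A   → Axiom Λ (□ A ⇔' ((¬' A) ▷ ⊥'))
  schema : ∀ {σ A} → σ ∈ Λ → Instance σ A → Axiom Λ A

infix 4 _⊢_

data _⊢_ (Λ : List Schema) : Fm → Set where
  ax   : ∀ {A} → Axiom Λ A → Λ ⊢ A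
  mp   : ∀ {A B} → Λ ⊢ A ⊃ B → Λ ⊢ A → Λ ⊢ B
  nec  : ∀ {A} → Λ ⊢ A → Λ ⊢ □ A
  r1   : ∀ {A B} C → Λ ⊢ A ⊃ B → Λ ⊢ (C ▷ A) ⊃ (C ▷ B)
  r2   : ∀ {A B} C → Λ ⊢ A ⊃ B → Λ ⊢ (B ▷ C) ⊃ (A ▷ C)

data TheLogic : Set where
  IL⁻J4 IL⁻J1J4 IL⁻J4J5 IL⁻J1J4J5 IL⁻J2 IL⁻J2J4+ : TheLogic

schemata : TheLogic → List Schema
schemata IL⁻J4     = J4 ∷ []
schemata IL⁻J1J4   = J1 ∷ J4 ∷ []
schemata IL⁻J4J5   = J4 ∷ J5 ∷ []
schemata IL⁻J1J4J5 = J1 ∷ J4 ∷ J5 ∷ []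
schemata IL⁻J2     = J2 ∷ []
schemata IL⁻J2J4+  = J2 ∷ J4+ ∷ []

Subset : Set → Set₁
Subset W = W → Set

_⊆_ : {W : Set} → Subset W → Subset W → Set
V ⊆ U = ∀ z → V z → U z

record ILSFrame : Set₁ where
  field
    W        : Set
    point    : W
    R        : W → W → Set
    S        : W → W → Subset W → Set     -- S x y V  means  y S_x V
    R-trans  : ∀ {x y z} → R x y → R y z → R x z
    R-cwf    : WellFounded (λ y x → R x y)
    S-R      : ∀ {x y V} → S x y V → R x y
    S-nonempty : ∀ {x y V} → S x y V → Σ W V
    S-mono   : ∀ {x y V U} → S x y V → V ⊆ U → S x y U

open ILSFrame public

Finite : ILSFrame → Set
Finite F = Σ ℕ λ n → W F ↔ Fin n

Sat : (F : ILSFrame) → (W F → ℕ → Set) → W F → Fm → Set₁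
Sat F val x (var p)  = Lift' (val x p)
  where Lift' = Level.Lift (Level.suc 0ℓ)
Sat F val x ⊤'       = Level.Lift _ ⊤
Sat F val x ⊥'       = Level.Lift _ ⊥
Sat F val x (¬' A)   = ¬ Sat F val x A
Sat F val x (A ∧' B) = Sat F val x A × Sat F val x B
Sat F val x (A ∨' B) = Sat F val x A ⊎ Sat F val x B
Sat F val x (A ⊃ B)  = Sat F val x A → Sat F val x B
Sat F val x (□ A)    = ∀ y → R F x y → Sat F val y A
Sat F val x (A ▷ B)  = ∀ y → R F x y → Sat F val y A →
  Σ (Subset (W F)) λ V → S F x y V × (∀ z → V z → Sat F val z B)

ValidIn : ILSFrame → Fm → Set₁
ValidIn F A = ∀ (val : W F → ℕ → Set) (x : W F) → Sat F val x A

LFrame : List Schema → ILSFrame → Set₁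
LFrame Λ F = ∀ A → Axiom Λ A → ValidIn F A

Classical : Setω
Classical = ∀ {ℓ} → ExcludedMiddle ℓ

module Submission where

-- Soundness is an induction on derivations; excluded middle reads a Boolean
-- valuation off every world, which validates the tautologies.
--
-- Completeness is a finite canonical model.  For unprovable A, let Φ₀ be the
-- subformulas of A ∧ ⋀{◇C | B ▷ C ∈ sub A} and Φ⁺ = Φ₀ ∪ {□(⋁s ⊃ ⋁t) | s,t ⊆ Φ₀}.
-- Worlds are the sign vectors over Φ⁺ ("types").  xRy: both are consistent,
-- y inherits the boxed Φ⁺-formulas of x with their bodies, and proves more of
-- them (so R is transitive and conversely well-founded).  y S_x V holds by a
-- φ ∈ Φ₀ proved at y with x ⊢ φ ▷ ⋁s, V containing the coherent ⋁s-worlds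
-- (only successors of x under J4₊); or, under J1, by y ∈ V; or, under J5, by
-- a successor of y in V.  A truth lemma for sub A and the validity of the
-- schemata in this frame give completeness.  Of the logic we only use that
-- it derives J4 and that J2 never occurs with J1 or J5.

open import Defs
open import Level using (0ℓ; lift) renaming (suc to lsuc)
open import Data.Nat using (ℕ; zero; suc; _+_; _<_; _≤_; z≤n; s≤s)
open import Data.Nat.Properties using (≤-refl; ≤-trans; +-mono-≤; ≤-reflexive; +-suc)
open import Data.Nat.Induction using (<-wellFounded)
open import Data.Bool using (Bool; true; false; not; _∧_; _∨_; T)
open import Data.Bool.Properties using (T-≡; T-∧)
open import Data.Unit using (tt)
open import Data.Empty using (⊥-elim) renaming (⊥ to Empty)
open import Data.Fin using (Fin; zero; suc; splitAt; _↑ˡ_; _↑ʳ_)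
open import Data.Fin.Properties using (splitAt-↑ˡ; splitAt-↑ʳ)
open import Data.Product using (Σ; _×_; _,_; proj₁; proj₂)
open import Data.Sum using (_⊎_; inj₁; inj₂)
open import Data.Vec using (Vec; []; _∷_; lookup; map; replicate)
open import Data.Vec.Properties using (lookup-map)
open import Data.List using (List; []; _∷_; _++_; length) renaming (map to mapL)
open import Data.List.Relation.Unary.Any using (here; there)
open import Data.List.Membership.Propositional using (_∈_)
open import Data.List.Membership.Propositional.Properties using (∈-++⁺ˡ; ∈-++⁺ʳ; ∈-++⁻; ∈-map⁺; ∈-map⁻)
open import Relation.Nullary using (¬_; Dec; yes; no; does)
open import Relation.Binary.PropositionalEquality using (_≡_; refl; sym; trans; cong; cong₂; subst)
import Relation.Binary.Construct.On as On
open import Induction.WellFounded using (Acc; acc; WellFounded; module Subrelation)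
open import Axiom.ExcludedMiddle using (ExcludedMiddle)
open import Function.Bundles using (_⇔_; mk⇔; Equivalence)
open import Function.Properties.Inverse using (↔-refl)

-- Propositional schemata over n letters.  A schema whose truth table is
-- constantly true has only tautologies as instances; this is how every
-- propositional step below is justified.

infixr 6 _⊃p_
infixr 7 _∨p_
infixr 8 _∧p_

data Schematic (n : ℕ) : Set where
  #_ : Fin n → Schematic n
  ⊤p ⊥p : Schematic n
  ¬p : Schematic n → Schematic n
  _∧p_ _∨p_ _⊃p_ : Schematic n → Schematic n → Schematic n

pattern #0 = # zero
pattern #1 = # (suc zero)
pattern #2 = # (suc (suc zero))
pattern #3 = # (suc (suc (suc zero)))

instantiate : ∀ {n} → Vec Fm n → Schematic n → Fm
instantiate σ (# i)    = lookup σ i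
instantiate σ ⊤p       = ⊤'
instantiate σ ⊥p       = ⊥'
instantiate σ (¬p p)   = ¬' instantiate σ p
instantiate σ (p ∧p q) = instantiate σ p ∧' instantiate σ q
instantiate σ (p ∨p q) = instantiate σ p ∨' instantiate σ q
instantiate σ (p ⊃p q) = instantiate σ p ⊃ instantiate σ q

evalSchematic : ∀ {n} → Vec Bool n → Schematic n → Bool
evalSchematic ρ (# i)    = lookup ρ i
evalSchematic ρ ⊤p       = true
evalSchematic ρ ⊥p       = false
evalSchematic ρ (¬p p)   = not (evalSchematic ρ p)
evalSchematic ρ (p ∧p q) = evalSchematic ρ p ∧ evalSchematic ρ q
evalSchematic ρ (p ∨p q) = evalSchematic ρ p ∨ evalSchematic ρ q
evalSchematic ρ (p ⊃p q) = evalSchematic ρ p ⇒ᵇ evalSchematic ρ q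

everyRow : ∀ n → (Vec Bool n → Bool) → Bool
everyRow zero    f = f []
everyRow (suc n) f = everyRow n (λ ρ → f (true ∷ ρ)) ∧ everyRow n (λ ρ → f (false ∷ ρ))

everyRow-sound : ∀ n f → T (everyRow n f) → ∀ ρ → f ρ ≡ true
everyRow-sound zero    f ok []         = Equivalence.to T-≡ ok
everyRow-sound (suc n) f ok (true ∷ ρ)  = everyRow-sound n _ (proj₁ (Equivalence.to T-∧ ok)) ρ
everyRow-sound (suc n) f ok (false ∷ ρ) = everyRow-sound n _ (proj₂ (Equivalence.to T-∧ ok)) ρ

evalB-instantiate : ∀ {n} (v : Fm → Bool) (σ : Vec Fm n) p →
                    evalB v (instantiate σ p) ≡ evalSchematic (map (evalB v) σ) p
evalB-instantiate v σ (# i)    = sym (lookup-map i (evalB v) σ)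
evalB-instantiate v σ ⊤p       = refl
evalB-instantiate v σ ⊥p       = refl
evalB-instantiate v σ (¬p p)   = cong not (evalB-instantiate v σ p)
evalB-instantiate v σ (p ∧p q) = cong₂ _∧_ (evalB-instantiate v σ p) (evalB-instantiate v σ q)
evalB-instantiate v σ (p ∨p q) = cong₂ _∨_ (evalB-instantiate v σ p) (evalB-instantiate v σ q)
evalB-instantiate v σ (p ⊃p q) = cong₂ _⇒ᵇ_ (evalB-instantiate v σ p) (evalB-instantiate v σ q)

-- The certificate: the implicit argument is computed away when p is valid.
tautology : ∀ {n} (σ : Vec Fm n) (p : Schematic n) →
            {valid : T (everyRow n (λ ρ → evalSchematic ρ p))} → Tautology (instantiate σ p)
tautology {n} σ p {valid} v =
  trans (evalB-instantiate v σ p) (everyRow-sound n (λ ρ → evalSchematic ρ p) valid (map (evalB v) σ))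

module Derivations (Λ : List Schema) where

  infix 4 _⊩_
  _⊩_ : Fm → Fm → Set
  c ⊩ X = Λ ⊢ c ⊃ X

  ⊢taut : ∀ {X} → Tautology X → Λ ⊢ X
  ⊢taut t = ax (taut t)

  mpTaut : ∀ {X Y} → Λ ⊢ X → Tautology (X ⊃ Y) → Λ ⊢ Y
  mpTaut d t = mp (⊢taut t) d

  ⊩mp : ∀ {c X Y} → Λ ⊢ X ⊃ Y → c ⊩ X → c ⊩ Y
  ⊩mp {c} {X} {Y} d e =
    mp (mpTaut d (tautology (c ∷ X ∷ Y ∷ []) ((#1 ⊃p #2) ⊃p (#0 ⊃p #1) ⊃p (#0 ⊃p #2)))) e

  ⊩mp2 : ∀ {c X Y Z} → Λ ⊢ X ⊃ Y ⊃ Z → c ⊩ X → c ⊩ Y → c ⊩ Z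
  ⊩mp2 {c} {X} {Y} {Z} d e f =
    mp (mp (mpTaut d (tautology (c ∷ X ∷ Y ∷ Z ∷ [])
          ((#1 ⊃p #2 ⊃p #3) ⊃p (#0 ⊃p #1) ⊃p (#0 ⊃p #2) ⊃p (#0 ⊃p #3)))) e) f

  ⊩taut : ∀ {c X Y} → Tautology (X ⊃ Y) → c ⊩ X → c ⊩ Y
  ⊩taut t = ⊩mp (⊢taut t)

  ⊩taut2 : ∀ {c X Y Z} → Tautology (X ⊃ Y ⊃ Z) → c ⊩ X → c ⊩ Y → c ⊩ Z
  ⊩taut2 t = ⊩mp2 (⊢taut t)

  ⊩app : ∀ {c X Y} → c ⊩ X ⊃ Y → c ⊩ X → c ⊩ Y
  ⊩app {X = X} {Y} = ⊩taut2 (tautology (X ∷ Y ∷ []) ((#0 ⊃p #1) ⊃p #0 ⊃p #1))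

  ⊩¬⊃-antecedent : ∀ {c X Y} → c ⊩ ¬' (X ⊃ Y) → c ⊩ X
  ⊩¬⊃-antecedent {X = X} {Y} = ⊩taut (tautology (X ∷ Y ∷ []) (¬p (#0 ⊃p #1) ⊃p #0))

  ⊩¬⊃-consequent : ∀ {c X Y} → c ⊩ ¬' (X ⊃ Y) → c ⊩ ¬' Y
  ⊩¬⊃-consequent {X = X} {Y} = ⊩taut (tautology (X ∷ Y ∷ []) (¬p (#0 ⊃p #1) ⊃p ¬p #1))

  ⊩thm : ∀ {c X} → Λ ⊢ X → c ⊩ X
  ⊩thm {c} {X} d = mpTaut d (tautology (X ∷ c ∷ []) (#0 ⊃p #1 ⊃p #0))

  ⊩refl : ∀ {c} → c ⊩ c
  ⊩refl {c} = ⊢taut (tautology (c ∷ []) (#0 ⊃p #0))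

  ⊃-trans : ∀ {X Y Z} → Λ ⊢ X ⊃ Y → Λ ⊢ Y ⊃ Z → Λ ⊢ X ⊃ Z
  ⊃-trans d e = ⊩mp e d

  □-mono : ∀ {X Y} → Λ ⊢ X ⊃ Y → Λ ⊢ □ X ⊃ □ Y
  □-mono d = mp (ax (axK _ _)) (nec d)

  ⊩□-mono : ∀ {c X Y} → Λ ⊢ X ⊃ Y → c ⊩ □ X → c ⊩ □ Y
  ⊩□-mono d = ⊩mp (□-mono d)

  ⊩□∧ : ∀ {c X Y} → c ⊩ □ X → c ⊩ □ Y → c ⊩ □ (X ∧' Y)
  ⊩□∧ {X = X} {Y} =
    ⊩mp2 (⊃-trans (□-mono (⊢taut (tautology (X ∷ Y ∷ []) (#0 ⊃p #1 ⊃p (#0 ∧p #1))))) (ax (axK _ _)))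

  □4 : ∀ {X} → Λ ⊢ □ X ⊃ □ □ X
  □4 {X} = ⊃-trans (□-mono X⊃□X∧□X⊃X∧□X) (⊃-trans (ax (axL (X ∧' □ X))) (□-mono (⊢taut (tautology (X ∷ □ X ∷ []) ((#0 ∧p #1) ⊃p #1)))))
    where
    X⊃□X∧□X⊃X∧□X : Λ ⊢ X ⊃ (□ (X ∧' □ X) ⊃ (X ∧' □ X))
    X⊃□X∧□X⊃X∧□X =
      mpTaut (□-mono (⊢taut (tautology (X ∷ □ X ∷ []) ((#0 ∧p #1) ⊃p #0))))
             (tautology (X ∷ □ X ∷ □ (X ∧' □ X) ∷ []) ((#2 ⊃p #1) ⊃p (#0 ⊃p (#2 ⊃p (#0 ∧p #1)))))

  ⊩□4 : ∀ {c X} → c ⊩ □ X → c ⊩ □ □ X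
  ⊩□4 = ⊩mp □4

  ⊩löb : ∀ {c X} → c ⊩ □ (□ X ⊃ X) → c ⊩ □ X
  ⊩löb = ⊩mp (ax (axL _))

  ⊩r1 : ∀ {c X Y Z} → Λ ⊢ X ⊃ Y → c ⊩ Z ▷ X → c ⊩ Z ▷ Y
  ⊩r1 {Z = Z} d = ⊩mp (r1 Z d)

  ⊩r2 : ∀ {c X Y Z} → Λ ⊢ X ⊃ Y → c ⊩ Y ▷ Z → c ⊩ X ▷ Z
  ⊩r2 {Z = Z} d = ⊩mp (r2 Z d)

  ⊩j3 : ∀ {c X Y Z} → c ⊩ X ▷ Z → c ⊩ Y ▷ Z → c ⊩ (X ∨' Y) ▷ Z
  ⊩j3 {X = X} {Y} {Z} e f =
    ⊩mp (ax (axJ3 X Y Z)) (⊩taut2 (tautology (X ▷ Z ∷ Y ▷ Z ∷ []) (#0 ⊃p #1 ⊃p (#0 ∧p #1))) e f)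

  ⊩j6→ : ∀ {c X} → c ⊩ □ X → c ⊩ (¬' X) ▷ ⊥'
  ⊩j6→ {X = X} =
    ⊩mp (mpTaut (ax (axJ6 X)) (tautology (□ X ∷ (¬' X) ▷ ⊥' ∷ []) (((#0 ⊃p #1) ∧p (#1 ⊃p #0)) ⊃p (#0 ⊃p #1))))

  ⊩j6← : ∀ {c X} → c ⊩ (¬' X) ▷ ⊥' → c ⊩ □ X
  ⊩j6← {X = X} =
    ⊩mp (mpTaut (ax (axJ6 X)) (tautology (□ X ∷ (¬' X) ▷ ⊥' ∷ []) (((#0 ⊃p #1) ∧p (#1 ⊃p #0)) ⊃p (#1 ⊃p #0))))

  ⊩□¬▷ : ∀ {c X Z} → c ⊩ □ (¬' X) → c ⊩ X ▷ Z
  ⊩□¬▷ {X = X} {Z} e =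
    ⊩r1 (⊢taut (tautology (Z ∷ []) (⊥p ⊃p #0))) (⊩r2 (⊢taut (tautology (X ∷ []) (#0 ⊃p ¬p (¬p #0)))) (⊩j6→ e))

  ⊩⊥▷ : ∀ {c Z} → c ⊩ ⊥' ▷ Z
  ⊩⊥▷ = ⊩□¬▷ (⊩thm (nec (⊢taut (tautology [] (¬p ⊥p)))))

  -- Strengthening the antecedent of ▷ along a necessary implication
  -- (J1 ∘ J2 without using either schema).
  ⊩□⊃▷ : ∀ {c X Y Z} → c ⊩ □ (X ⊃ Y) → c ⊩ Y ▷ Z → c ⊩ X ▷ Z
  ⊩□⊃▷ {X = X} {Y} {Z} b e =
    ⊩r2 (⊢taut (tautology (X ∷ Y ∷ []) (#0 ⊃p ((#0 ∧p #1) ∨p (#0 ∧p ¬p #1)))))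
      (⊩j3 {X = X ∧' Y} {Y = X ∧' ¬' Y}
        (⊩r2 (⊢taut (tautology (X ∷ Y ∷ []) ((#0 ∧p #1) ⊃p #1))) e)
        (⊩□¬▷ (⊩□-mono (⊢taut (tautology (X ∷ Y ∷ []) ((#0 ⊃p #1) ⊃p ¬p (#0 ∧p ¬p #1)))) b)))

  ⊩schema : ∀ {c σ X} → σ ∈ Λ → Instance σ X → c ⊩ X
  ⊩schema m i = ⊩thm (ax (schema m i))

-- Excluded middle (for Set₁) turns satisfaction at a world into
-- a Boolean valuation, so tautologies are valid; the remaining axioms and
-- rules are checked directly, Löb's axiom by converse well-foundedness.

module Soundness (lem : ExcludedMiddle (lsuc 0ℓ)) (F : ILSFrame) where

  false≢true : false ≡ true → Empty
  false≢true ()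

  module _ (val : W F → ℕ → Set) (x : W F) where

    valuationAt : Fm → Bool
    valuationAt X = does (lem {Sat F val x X})

    decided-atom : ∀ X → (Sat F val x X → valuationAt X ≡ true) × (valuationAt X ≡ true → Sat F val x X)
    decided-atom X with lem {Sat F val x X}
    ... | yes s = (λ _ → refl) , (λ _ → s)
    ... | no ¬s = (λ s → ⊥-elim (¬s s)) , (λ ())

    sat⇔evalB : ∀ X → (Sat F val x X → evalB valuationAt X ≡ true) × (evalB valuationAt X ≡ true → Sat F val x X)
    sat⇔evalB (var p) = decided-atom (var p)
    sat⇔evalB (□ X)   = decided-atom (□ X)
    sat⇔evalB (X ▷ Y) = decided-atom (X ▷ Y)
    sat⇔evalB ⊤'      = (λ _ → refl) , (λ _ → lift tt)
    sat⇔evalB ⊥'      = (λ { (lift ()) }) , (λ ())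
    sat⇔evalB (¬' X) with evalB valuationAt X | sat⇔evalB X
    ... | true  | (_ , fromX) = (λ ¬s → ⊥-elim (¬s (fromX refl))) , (λ ())
    ... | false | (toX , _)   = (λ _ → refl) , (λ _ s → false≢true (toX s))
    sat⇔evalB (X ∧' Y) with evalB valuationAt X | sat⇔evalB X | evalB valuationAt Y | sat⇔evalB Y
    ... | true  | (_ , fX)  | true  | (_ , fY)  = (λ _ → refl) , (λ _ → fX refl , fY refl)
    ... | true  | _         | false | (tY , _)  = (λ s → tY (proj₂ s)) , (λ ())
    ... | false | (tX , _)  | _     | _         = (λ s → tX (proj₁ s)) , (λ ())
    sat⇔evalB (X ∨' Y) with evalB valuationAt X | sat⇔evalB X | evalB valuationAt Y | sat⇔evalB Y
    ... | true  | (_ , fX)  | _     | _         = (λ _ → refl) , (λ _ → inj₁ (fX refl))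
    ... | false | _         | true  | (_ , fY)  = (λ _ → refl) , (λ _ → inj₂ (fY refl))
    ... | false | (tX , _)  | false | (tY , _)  = (λ { (inj₁ s) → tX s ; (inj₂ s) → tY s }) , (λ ())
    sat⇔evalB (X ⊃ Y) with evalB valuationAt X | sat⇔evalB X | evalB valuationAt Y | sat⇔evalB Y
    ... | true  | _         | true  | (_ , fY)  = (λ _ → refl) , (λ _ _ → fY refl)
    ... | true  | (_ , fX)  | false | (tY , _)  = (λ s → tY (s (fX refl))) , (λ ())
    ... | false | (tX , _)  | _     | _         = (λ _ → refl) , (λ _ s → ⊥-elim (false≢true (tX s)))

  taut-valid : ∀ {A} → Tautology A → ValidIn F A
  taut-valid {A} t val x = proj₂ (sat⇔evalB val x A) (t (valuationAt val x))

  K-valid : ∀ A B → ValidIn F (□ (A ⊃ B) ⊃ (□ A ⊃ □ B))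
  K-valid A B val x □A⊃B □A y r = □A⊃B y r (□A y r)

  Löb-valid : ∀ A → ValidIn F (□ (□ A ⊃ A) ⊃ □ A)
  Löb-valid A val x h y r = below y (R-cwf F y) r
    where
    below : ∀ y → Acc (λ a b → R F b a) y → R F x y → Sat F val y A
    below y (acc rs) r = h y r (λ z ryz → below z (rs ryz) (R-trans F r ryz))

  J3-valid : ∀ A B C → ValidIn F ((A ▷ C) ∧' (B ▷ C) ⊃ (A ∨' B) ▷ C)
  J3-valid A B C val x (h₁ , h₂) y r (inj₁ s) = h₁ y r s
  J3-valid A B C val x (h₁ , h₂) y r (inj₂ s) = h₂ y r s

  -- The right-to-left half of J6 uses that S-sets are nonempty.
  J6-valid : ∀ A → ValidIn F (□ A ⇔' ((¬' A) ▷ ⊥'))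
  J6-valid A val x = (λ □A y r ¬A → ⊥-elim (¬A (□A y r))) , λ h y r → byCases y r (lem {Sat F val y A}) h
    where
    byCases : ∀ y → R F x y → Dec (Sat F val y A) → Sat F val x ((¬' A) ▷ ⊥') → Sat F val y A
    byCases y r (yes s) h = s
    byCases y r (no ¬s) h with h y r ¬s
    ... | (V , ySV , V⊨⊥) with S-nonempty F ySV
    ... | (z , z∈V) with V⊨⊥ z z∈V
    ... | lift ()

  LFrame-from-schemata : ∀ Λ → (∀ {σ A} → σ ∈ Λ → Instance σ A → ValidIn F A) → LFrame Λ F
  LFrame-from-schemata Λ h A (taut t)     = taut-valid t
  LFrame-from-schemata Λ h _ (axK A B)    = K-valid A B
  LFrame-from-schemata Λ h _ (axL A)      = Löb-valid A
  LFrame-from-schemata Λ h _ (axJ3 A B C) = J3-valid A B C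
  LFrame-from-schemata Λ h _ (axJ6 A)     = J6-valid A
  LFrame-from-schemata Λ h A (schema m i) = h m i

  soundness : ∀ {Λ} → LFrame Λ F → ∀ {A} → Λ ⊢ A → ValidIn F A
  soundness lf (ax a)   = lf _ a
  soundness lf (mp d e) val x = soundness lf d val x (soundness lf e val x)
  soundness lf (nec d)  val x y _ = soundness lf d val y
  soundness lf (r1 C d) val x h y r sC with h y r sC
  ... | (V , ySV , V⊨A) = V , ySV , λ z z∈V → soundness lf d val z (V⊨A z z∈V)
  soundness lf (r2 C d) val x h y r sA = h y r (soundness lf d val y sA)

-- Consistent such conjunctions play the role of maximal consistent sets
-- restricted to L.

module FiniteTypes (Λ : List Schema) (lem : ExcludedMiddle 0ℓ) where
  open Derivations Λ

  literal : Bool → Fm → Fm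
  literal true  X = X
  literal false X = ¬' X

  ⟪_∣_⟫ : (L : List Fm) → Vec Bool (length L) → Fm
  ⟪ []    ∣ []    ⟫ = ⊤'
  ⟪ X ∷ L ∣ b ∷ v ⟫ = literal b X ∧' ⟪ L ∣ v ⟫

  Decides : Fm → Fm → Set
  Decides g X = g ⊩ X ⊎ g ⊩ ¬' X

  Consistent : Fm → Set
  Consistent g = ¬ (g ⊩ ⊥')

  type-decides : ∀ {X} (L : List Fm) → X ∈ L → (v : Vec Bool (length L)) → Decides ⟪ L ∣ v ⟫ X
  type-decides {X} (.X ∷ L) (here refl) (true ∷ v)  = inj₁ (⊢taut (tautology (X ∷ ⟪ L ∣ v ⟫ ∷ []) ((#0 ∧p #1) ⊃p #0)))
  type-decides {X} (.X ∷ L) (here refl) (false ∷ v) = inj₂ (⊢taut (tautology (X ∷ ⟪ L ∣ v ⟫ ∷ []) ((¬p #0 ∧p #1) ⊃p ¬p #0)))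
  type-decides {X} (Y ∷ L) (there m) (b ∷ v) with type-decides L m v
  ... | inj₁ d = inj₁ (⊃-trans (⊢taut (tautology (literal b Y ∷ ⟪ L ∣ v ⟫ ∷ []) ((#0 ∧p #1) ⊃p #1))) d)
  ... | inj₂ d = inj₂ (⊃-trans (⊢taut (tautology (literal b Y ∷ ⟪ L ∣ v ⟫ ∷ []) ((#0 ∧p #1) ⊃p #1))) d)

  lindenbaum : (L : List Fm) (c : Fm) → Consistent c →
               Σ (Vec Bool (length L)) λ v → Consistent (c ∧' ⟪ L ∣ v ⟫)
  lindenbaum [] c k = [] , λ d → k (⊃-trans (⊢taut (tautology (c ∷ []) (#0 ⊃p (#0 ∧p ⊤p)))) d)
  lindenbaum (X ∷ L) c k with lem {(c ∧' X) ⊩ ⊥'}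
  ... | no kX with lindenbaum L (c ∧' X) kX
  ...   | (v , kv) = (true ∷ v) , λ d →
          kv (⊃-trans (⊢taut (tautology (c ∷ X ∷ ⟪ L ∣ v ⟫ ∷ []) (((#0 ∧p #1) ∧p #2) ⊃p (#0 ∧p (#1 ∧p #2))))) d)
  lindenbaum (X ∷ L) c k | yes c∧X⊩⊥ with lindenbaum L (c ∧' ¬' X)
      (λ d → k (mp (mp (⊢taut (tautology (c ∷ X ∷ [])
           (((#0 ∧p #1) ⊃p ⊥p) ⊃p ((#0 ∧p ¬p #1) ⊃p ⊥p) ⊃p (#0 ⊃p ⊥p)))) c∧X⊩⊥) d))
  ...   | (v , kv) = (false ∷ v) , λ d →
          kv (⊃-trans (⊢taut (tautology (c ∷ ¬' X ∷ ⟪ L ∣ v ⟫ ∷ []) (((#0 ∧p #1) ∧p #2) ⊃p (#0 ∧p (#1 ∧p #2))))) d)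

  forced : ∀ {c g Z} → Consistent (c ∧' g) → Λ ⊢ c ⊃ Z → Decides g Z → g ⊩ Z
  forced k d (inj₁ e) = e
  forced {c} {g} {Z} k d (inj₂ e) =
    ⊥-elim (k (mp (mp (⊢taut (tautology (c ∷ g ∷ Z ∷ [])
      ((#0 ⊃p #2) ⊃p (#1 ⊃p ¬p #2) ⊃p ((#0 ∧p #1) ⊃p ⊥p)))) d) e))

  consistent-right : ∀ {c g} → Consistent (c ∧' g) → Consistent g
  consistent-right {c} {g} k d = k (⊃-trans (⊢taut (tautology (c ∷ g ∷ []) ((#0 ∧p #1) ⊃p #1))) d)

  contradiction : ∀ {g X} → Consistent g → g ⊩ X → g ⊩ ¬' X → Empty
  contradiction {g} {X} k d e = k (⊩taut2 (tautology (X ∷ []) (#0 ⊃p ¬p #0 ⊃p ⊥p)) d e)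

  decides-¬-of-not : ∀ {g X} → Decides g X → ¬ (g ⊩ X) → g ⊩ ¬' X
  decides-¬-of-not (inj₁ d) n = ⊥-elim (n d)
  decides-¬-of-not (inj₂ d) n = d

  decides-¬ : ∀ {g X} → Decides g X → Decides g (¬' X)
  decides-¬ {X = X} (inj₁ d) = inj₂ (⊩taut (tautology (X ∷ []) (#0 ⊃p ¬p (¬p #0))) d)
  decides-¬ (inj₂ d) = inj₁ d

  decides-∨ : ∀ {g X Y} → Decides g X → Decides g Y → Decides g (X ∨' Y)
  decides-∨ {X = X} {Y} (inj₂ d) (inj₂ e) = inj₂ (⊩taut2 (tautology (X ∷ Y ∷ []) (¬p #0 ⊃p ¬p #1 ⊃p ¬p (#0 ∨p #1))) d e)
  decides-∨ {X = X} {Y} (inj₁ d) e        = inj₁ (⊩taut (tautology (X ∷ Y ∷ []) (#0 ⊃p (#0 ∨p #1))) d)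
  decides-∨ {X = X} {Y} (inj₂ d) (inj₁ e) = inj₁ (⊩taut (tautology (X ∷ Y ∷ []) (#1 ⊃p (#0 ∨p #1))) e)

  decides-⊃ : ∀ {g X Y} → Decides g X → Decides g Y → Decides g (X ⊃ Y)
  decides-⊃ {X = X} {Y} (inj₁ d) (inj₂ e) = inj₂ (⊩taut2 (tautology (X ∷ Y ∷ []) (#0 ⊃p ¬p #1 ⊃p ¬p (#0 ⊃p #1))) d e)
  decides-⊃ {X = X} {Y} (inj₂ d) e        = inj₁ (⊩taut (tautology (X ∷ Y ∷ []) (¬p #0 ⊃p (#0 ⊃p #1))) d)
  decides-⊃ {X = X} {Y} (inj₁ d) (inj₁ e) = inj₁ (⊩taut (tautology (X ∷ Y ∷ []) (#1 ⊃p (#0 ⊃p #1))) e)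

  decides-⊥ : ∀ {g} → Decides g ⊥'
  decides-⊥ {g} = inj₂ (⊢taut (tautology (g ∷ []) (#0 ⊃p ¬p ⊥p)))

  -- Selections: a sign vector s over L selects a sublist, ⋁ L s is its
  -- disjunction.  Sets of formulas enter the construction only this way.
  ⋁ : (L : List Fm) → Vec Bool (length L) → Fm
  ⋁ []      []          = ⊥'
  ⋁ (X ∷ L) (true ∷ s)  = X ∨' ⋁ L s
  ⋁ (X ∷ L) (false ∷ s) = ⋁ L s

  data Selected : (L : List Fm) → Vec Bool (length L) → Fm → Set where
    this  : ∀ {X L s} → Selected (X ∷ L) (true ∷ s) X
    later : ∀ {X Y L b s} → Selected L s Y → Selected (X ∷ L) (b ∷ s) Y

  selected-∈ : ∀ {L s X} → Selected L s X → X ∈ L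
  selected-∈ this      = here refl
  selected-∈ (later p) = there (selected-∈ p)

  ⋁-intro : ∀ {L s X} → Selected L s X → Λ ⊢ X ⊃ ⋁ L s
  ⋁-intro {X ∷ L} {true ∷ s} this = ⊢taut (tautology (X ∷ ⋁ L s ∷ []) (#0 ⊃p (#0 ∨p #1)))
  ⋁-intro {Y ∷ L} {true ∷ s} (later p) = ⊃-trans (⋁-intro p) (⊢taut (tautology (Y ∷ ⋁ L s ∷ []) (#1 ⊃p (#0 ∨p #1))))
  ⋁-intro {Y ∷ L} {false ∷ s} (later p) = ⋁-intro p

  ⊩⋁-elim : ∀ {L s c Y} → (∀ X → Selected L s X → c ⊩ X ⊃ Y) → c ⊩ ⋁ L s ⊃ Y
  ⊩⋁-elim {[]}    {[]}        {c} {Y} h = ⊢taut (tautology (c ∷ Y ∷ []) (#0 ⊃p (⊥p ⊃p #1)))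
  ⊩⋁-elim {X ∷ L} {true ∷ s}  {c} {Y} h =
    ⊩taut2 (tautology (X ∷ ⋁ L s ∷ Y ∷ []) ((#0 ⊃p #2) ⊃p (#1 ⊃p #2) ⊃p ((#0 ∨p #1) ⊃p #2)))
           (h X this) (⊩⋁-elim (λ Z p → h Z (later p)))
  ⊩⋁-elim {X ∷ L} {false ∷ s} h = ⊩⋁-elim (λ Z p → h Z (later p))

  ⋁-elim : ∀ {L s Y} → (∀ X → Selected L s X → Λ ⊢ X ⊃ Y) → Λ ⊢ ⋁ L s ⊃ Y
  ⋁-elim h = mp (⊩⋁-elim {c = ⊤'} (λ X p → ⊩thm (h X p))) (⊢taut (tautology [] ⊤p))

  ⋁-▷ : ∀ {L s c Z} → (∀ X → Selected L s X → c ⊩ X ▷ Z) → c ⊩ ⋁ L s ▷ Z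
  ⋁-▷ {[]}    {[]}        h = ⊩⊥▷
  ⋁-▷ {X ∷ L} {true ∷ s}  h = ⊩j3 (h X this) (⋁-▷ (λ Y p → h Y (later p)))
  ⋁-▷ {X ∷ L} {false ∷ s} h = ⋁-▷ (λ Y p → h Y (later p))

  decides-⋁ : ∀ {L s g} → (∀ X → X ∈ L → Decides g X) → Decides g (⋁ L s)
  decides-⋁ {[]}    {[]}        h = decides-⊥
  decides-⋁ {X ∷ L} {true ∷ s}  h = decides-∨ (h X (here refl)) (decides-⋁ (λ Y m → h Y (there m)))
  decides-⋁ {X ∷ L} {false ∷ s} h = decides-⋁ (λ Y m → h Y (there m))

  ⋁-witness : ∀ {L s g} → Consistent g → (∀ X → X ∈ L → Decides g X) → g ⊩ ⋁ L s →
              Σ Fm λ X → Selected L s X × g ⊩ X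
  ⋁-witness {[]} {[]} k h d = ⊥-elim (k d)
  ⋁-witness {X ∷ L} {true ∷ s} {g} k h d with h X (here refl)
  ... | inj₁ e = X , this , e
  ... | inj₂ e with ⋁-witness {L} {s} k (λ Y m → h Y (there m))
                      (⊩taut2 (tautology (X ∷ ⋁ L s ∷ []) ((#0 ∨p #1) ⊃p ¬p #0 ⊃p #1)) d e)
  ...   | (Y , p , f) = Y , later p , f
  ⋁-witness {X ∷ L} {false ∷ s} k h d with ⋁-witness {L} {s} k (λ Y m → h Y (there m)) d
  ... | (Y , p , f) = Y , later p , f

  selection : (L : List Fm) → (Fm → Set) → Vec Bool (length L)
  selection []      P = []
  selection (X ∷ L) P = does (lem {P X}) ∷ selection L P

  selection⁺ : ∀ {L P X} → X ∈ L → P X → Selected L (selection L P) X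
  selection⁺ {X ∷ L} {P} (here refl) pX with lem {P X}
  ... | yes _ = this
  ... | no ¬pX = ⊥-elim (¬pX pX)
  selection⁺ {Y ∷ L} (there m) pX = later (selection⁺ m pX)

  selection⁻ : ∀ {L P X} → Selected L (selection L P) X → P X
  selection⁻ {X ∷ L} {P} p with lem {P X} | p
  ... | yes pX | this    = pX
  ... | yes _  | later q = selection⁻ q
  ... | no _   | later q = selection⁻ q

  sub properSub : Fm → List Fm
  sub X = X ∷ properSub X
  properSub (var p)  = []
  properSub ⊤'       = []
  properSub ⊥'       = []
  properSub (¬' X)   = sub X
  properSub (X ∧' Y) = sub X ++ sub Y
  properSub (X ∨' Y) = sub X ++ sub Y
  properSub (X ⊃ Y)  = sub X ++ sub Y
  properSub (□ X)    = sub X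
  properSub (X ▷ Y)  = sub X ++ sub Y

  sub-trans : ∀ X {Y Z} → Y ∈ sub X → Z ∈ sub Y → Z ∈ sub X
  sub-trans-++ : ∀ X Y {U Z} → U ∈ sub X ++ sub Y → Z ∈ sub U → Z ∈ sub X ++ sub Y
  sub-trans-++ X Y m k with ∈-++⁻ (sub X) m
  ... | inj₁ a = ∈-++⁺ˡ (sub-trans X a k)
  ... | inj₂ b = ∈-++⁺ʳ (sub X) (sub-trans Y b k)
  sub-trans X (here refl) m = m
  sub-trans (¬' X)   (there m) k = there (sub-trans X m k)
  sub-trans (□ X)    (there m) k = there (sub-trans X m k)
  sub-trans (X ∧' Y) (there m) k = there (sub-trans-++ X Y m k)
  sub-trans (X ∨' Y) (there m) k = there (sub-trans-++ X Y m k)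
  sub-trans (X ⊃ Y)  (there m) k = there (sub-trans-++ X Y m k)
  sub-trans (X ▷ Y)  (there m) k = there (sub-trans-++ X Y m k)

  allVectors : ∀ n → List (Vec Bool n)
  allVectors zero    = [] ∷ []
  allVectors (suc n) = mapL (true ∷_) (allVectors n) ++ mapL (false ∷_) (allVectors n)

  allVectors-complete : ∀ {n} (v : Vec Bool n) → v ∈ allVectors n
  allVectors-complete [] = here refl
  allVectors-complete {suc n} (true ∷ v)  = ∈-++⁺ˡ (∈-map⁺ (true ∷_) (allVectors-complete v))
  allVectors-complete {suc n} (false ∷ v) = ∈-++⁺ʳ (mapL (true ∷_) (allVectors n)) (∈-map⁺ (false ∷_) (allVectors-complete v))

  -- missing L Q counts the members of L outside Q.  Enlarging Q on L
  -- decreases it, strictly if a new member of L enters Q; this is the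
  -- measure making the canonical R conversely well-founded.
  indicator : ∀ {P : Set} → Dec P → ℕ
  indicator (yes _) = 0
  indicator (no _)  = 1

  missing : List Fm → (Fm → Set) → ℕ
  missing []      Q = 0
  missing (X ∷ L) Q = indicator (lem {Q X}) + missing L Q

  indicator-antitone : ∀ {P P' : Set} → (P → P') → indicator (lem {P'}) ≤ indicator (lem {P})
  indicator-antitone {P} {P'} P⇒P' with lem {P'} | lem {P}
  ... | yes _ | _     = z≤n
  ... | no _  | no _  = ≤-refl
  ... | no ¬p' | yes p = ⊥-elim (¬p' (P⇒P' p))

  missing-antitone : ∀ L (Q Q' : Fm → Set) → (∀ X → X ∈ L → Q X → Q' X) → missing L Q' ≤ missing L Q
  missing-antitone []      Q Q' h = z≤n
  missing-antitone (X ∷ L) Q Q' h =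
    +-mono-≤ (indicator-antitone (h X (here refl))) (missing-antitone L Q Q' (λ Y m → h Y (there m)))

  missing-strict : ∀ L (Q Q' : Fm → Set) → (∀ X → X ∈ L → Q X → Q' X) →
                   Σ Fm (λ X → X ∈ L × Q' X × ¬ Q X) → missing L Q' < missing L Q
  missing-strict (Y ∷ L) Q Q' h (X , here refl , q' , ¬q) with lem {Q' X} | lem {Q X}
  ... | _      | yes q = ⊥-elim (¬q q)
  ... | no ¬q' | _     = ⊥-elim (¬q' q')
  ... | yes _  | no _  = s≤s (missing-antitone L Q Q' (λ Z m → h Z (there m)))
  missing-strict (Y ∷ L) Q Q' h (X , there m , q' , ¬q) =
    ≤-trans (≤-reflexive (sym (+-suc _ _)))
            (+-mono-≤ (indicator-antitone (h Y (here refl)))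
                      (missing-strict L Q Q' (λ Z m → h Z (there m)) (X , m , q' , ¬q)))

-- Sign vectors of length n, coded by Fin (2ⁿ); the canonical worlds are
-- these codes, so that the canonical frame is Finite by definition.

pow2 : ℕ → ℕ
pow2 zero    = 1
pow2 (suc n) = pow2 n + pow2 n

decodeVec : ∀ n → Fin (pow2 n) → Vec Bool n
decodeVec zero    i = []
decodeVec (suc n) i with splitAt (pow2 n) i
... | inj₁ j = true ∷ decodeVec n j
... | inj₂ j = false ∷ decodeVec n j

encodeVec : ∀ n → Vec Bool n → Fin (pow2 n)
encodeVec zero    []          = zero
encodeVec (suc n) (true ∷ v)  = encodeVec n v ↑ˡ pow2 n
encodeVec (suc n) (false ∷ v) = pow2 n ↑ʳ encodeVec n v

decode-encode : ∀ n v → decodeVec n (encodeVec n v) ≡ v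
decode-encode zero [] = refl
decode-encode (suc n) (true ∷ v)
  rewrite splitAt-↑ˡ (pow2 n) (encodeVec n v) (pow2 n) = cong (true ∷_) (decode-encode n v)
decode-encode (suc n) (false ∷ v)
  rewrite splitAt-↑ʳ (pow2 n) (pow2 n) (encodeVec n v) = cong (false ∷_) (decode-encode n v)

module Canonical (Λ : List Schema) (lem₀ : ExcludedMiddle 0ℓ) (lem₁ : ExcludedMiddle (lsuc 0ℓ))
                 (J4-derivable : ∀ X Y → Λ ⊢ X ▷ Y ⊃ (◇ X ⊃ ◇ Y))
                 (J2-alone : J2 ∈ Λ → (¬ J1 ∈ Λ) × (¬ J5 ∈ Λ)) (A : Fm) where
  open Derivations Λ
  open FiniteTypes Λ lem₀

  ◇consequent : Fm → Fm
  ◇consequent (X ▷ Y) = ◇ Y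
  ◇consequent _       = ⊤'

  ◇consequents : List Fm → Fm
  ◇consequents []      = ⊤'
  ◇consequents (X ∷ L) = ◇consequent X ∧' ◇consequents L

  Φ₀ : List Fm
  Φ₀ = sub (A ∧' ◇consequents (sub A))

  n₀ : ℕ
  n₀ = length Φ₀

  Sel₀ : Set
  Sel₀ = Vec Bool n₀

  ⋁₀ : Sel₀ → Fm
  ⋁₀ = ⋁ Φ₀

  □⊃ : Sel₀ → Sel₀ → Fm
  □⊃ s t = □ (⋁₀ s ⊃ ⋁₀ t)

  boxedImplications : List Sel₀ → List Fm
  boxedImplications []       = []
  boxedImplications (s ∷ ss) = mapL (□⊃ s) (allVectors n₀) ++ boxedImplications ss

  Φ⁺ : List Fm
  Φ⁺ = Φ₀ ++ boxedImplications (allVectors n₀)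

  k : ℕ
  k = length Φ⁺

  sub-A⊆Φ₀ : ∀ {X} → X ∈ sub A → X ∈ Φ₀
  sub-A⊆Φ₀ m = there (∈-++⁺ˡ m)

  ◇consequent-∈ : ∀ {B C} L → (B ▷ C) ∈ L → ◇ C ∈ sub (◇consequents L)
  ◇consequent-∈ {C = C} (X ∷ L) (here refl) = there (∈-++⁺ˡ {xs = sub (◇ C)} {ys = sub (◇consequents L)} (here refl))
  ◇consequent-∈ (X ∷ L) (there m) = there (∈-++⁺ʳ (sub (◇consequent X)) (◇consequent-∈ L m))

  ◇C∈Φ₀ : ∀ {B C} → (B ▷ C) ∈ sub A → ◇ C ∈ Φ₀
  ◇C∈Φ₀ m = there (∈-++⁺ʳ (sub A) (◇consequent-∈ (sub A) m))

  Φ₀⊆Φ⁺ : ∀ {X} → X ∈ Φ₀ → X ∈ Φ⁺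
  Φ₀⊆Φ⁺ = ∈-++⁺ˡ

  □⊃-∈ : ∀ {s t ss} → s ∈ ss → □⊃ s t ∈ boxedImplications ss
  □⊃-∈ {t = t} {s' ∷ ss} (here refl) = ∈-++⁺ˡ {ys = boxedImplications ss} (∈-map⁺ (□⊃ s') (allVectors-complete t))
  □⊃-∈ {s} {t} {s' ∷ ss} (there m) = ∈-++⁺ʳ (mapL (□⊃ s') (allVectors n₀)) (□⊃-∈ {s} {t} m)

  □⊃-∈⁻ : ∀ {X} ss → X ∈ boxedImplications ss → Σ Sel₀ λ s → Σ Sel₀ λ t → X ≡ □⊃ s t
  □⊃-∈⁻ (s ∷ ss) m with ∈-++⁻ (mapL (□⊃ s) (allVectors n₀)) m
  ... | inj₁ a with ∈-map⁻ (□⊃ s) a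
  ...   | (t , _ , eq) = s , t , eq
  □⊃-∈⁻ (s ∷ ss) m | inj₂ b = □⊃-∈⁻ ss b

  □⊃∈Φ⁺ : ∀ s t → □⊃ s t ∈ Φ⁺
  □⊃∈Φ⁺ s t = ∈-++⁺ʳ Φ₀ (□⊃-∈ {s} {t} (allVectors-complete s))

  Type : Set
  Type = Vec Bool k

  ⟨_⟩ : Type → Fm
  ⟨ v ⟩ = ⟪ Φ⁺ ∣ v ⟫

  decides-Φ₀ : ∀ {X} v → X ∈ Φ₀ → Decides ⟨ v ⟩ X
  decides-Φ₀ v m = type-decides Φ⁺ (Φ₀⊆Φ⁺ m) v

  decides-⋁₀ : ∀ v s → Decides ⟨ v ⟩ (⋁₀ s)
  decides-⋁₀ v s = decides-⋁ {s = s} (λ X m → decides-Φ₀ v m)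

  decides-body : ∀ {ψ} v → □ ψ ∈ Φ⁺ → Decides ⟨ v ⟩ ψ
  decides-body v m with ∈-++⁻ Φ₀ m
  ... | inj₁ a = decides-Φ₀ v (sub-trans (A ∧' ◇consequents (sub A)) a (there (here refl)))
  ... | inj₂ b with □⊃-∈⁻ (allVectors n₀) b
  ...   | (s , t , refl) = decides-⊃ {X = ⋁₀ s} {Y = ⋁₀ t} (decides-⋁₀ v s) (decides-⋁₀ v t)

  Inherits : Type → Type → Set
  Inherits v u = ∀ ψ → □ ψ ∈ Φ⁺ → ⟨ v ⟩ ⊩ □ ψ → (⟨ u ⟩ ⊩ ψ) × (⟨ u ⟩ ⊩ □ ψ)

  _≺_ : Type → Type → Set
  v ≺ u = Consistent ⟨ v ⟩ × Consistent ⟨ u ⟩ × Inherits v u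
        × Σ Fm (λ ψ → □ ψ ∈ Φ⁺ × (⟨ u ⟩ ⊩ □ ψ) × ¬ (⟨ v ⟩ ⊩ □ ψ))

  ≺-trans : ∀ {a b c} → a ≺ b → b ≺ c → a ≺ c
  ≺-trans (ka , _ , ab , _) (_ , kc , bc , (ψ , m , c□ψ , ¬a□ψ)) =
    ka , kc , (λ φ mφ e → bc φ mφ (proj₂ (ab φ mφ e))) , (ψ , m , c□ψ , λ e → ¬a□ψ (proj₂ (ab ψ m e)))

  ProvedBox : Type → Fm → Set
  ProvedBox v X = Σ Fm (λ ψ → X ≡ □ ψ) × (⟨ v ⟩ ⊩ X)

  unprovedBoxes : Type → ℕ
  unprovedBoxes v = missing Φ⁺ (ProvedBox v)

  ≺-decreases : ∀ {v u} → v ≺ u → unprovedBoxes u < unprovedBoxes v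
  ≺-decreases {v} {u} (_ , _ , inh , (ψ , m , u□ψ , ¬v□ψ)) = missing-strict Φ⁺ (ProvedBox v) (ProvedBox u)
    (λ { X mX ((φ , refl) , e) → (φ , refl) , proj₂ (inh φ mX e) })
    (□ ψ , m , ((ψ , refl) , u□ψ) , λ { ((φ , refl) , e) → ¬v□ψ e })

  -- It extends
  --   (⋀{φ ∧ □φ | □φ ∈ Φ⁺ proved by v}) ∧ □ψ ∧ ¬ψ,
  -- which is consistent by Löb's axiom.
  module BoxWitness (v : Type) where
    ProvedBoxHere : Fm → Set
    ProvedBoxHere X = Σ Fm λ ψ → (X ≡ □ ψ) × (⟨ v ⟩ ⊩ X)

    boxedConjunct : (X R : Fm) → Dec (ProvedBoxHere X) → Fm
    boxedConjunct X R (yes (ψ , _)) = (ψ ∧' □ ψ) ∧' R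
    boxedConjunct X R (no _)        = R

    boxedPart : List Fm → Fm
    boxedPart []      = ⊤'
    boxedPart (X ∷ L) = boxedConjunct X (boxedPart L) (lem₀ {ProvedBoxHere X})

    boxedConjunct-⊃ : ∀ X R d → Λ ⊢ boxedConjunct X R d ⊃ R
    boxedConjunct-⊃ X R (yes (ψ , _)) = ⊢taut (tautology (ψ ∧' □ ψ ∷ R ∷ []) ((#0 ∧p #1) ⊃p #1))
    boxedConjunct-⊃ X R (no _)        = ⊩refl

    boxedPart-□ : ∀ L → ⟨ v ⟩ ⊩ □ (boxedPart L)
    boxedPart-□ [] = ⊩thm (nec (⊢taut (tautology [] ⊤p)))
    boxedPart-□ (X ∷ L) with lem₀ {ProvedBoxHere X}
    ... | yes (ψ , refl , d) = ⊩□∧ (⊩□∧ d (⊩□4 d)) (boxedPart-□ L)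
    ... | no _ = boxedPart-□ L

    boxedPart-⊃ : ∀ {ψ} L → □ ψ ∈ L → ⟨ v ⟩ ⊩ □ ψ → Λ ⊢ boxedPart L ⊃ (ψ ∧' □ ψ)
    boxedPart-⊃ (X ∷ L) (here refl) d with lem₀ {ProvedBoxHere X}
    ... | yes (ψ , refl , _) = ⊢taut (tautology (ψ ∧' □ ψ ∷ boxedPart L ∷ []) ((#0 ∧p #1) ⊃p #0))
    ... | no ¬h = ⊥-elim (¬h (_ , refl , d))
    boxedPart-⊃ (X ∷ L) (there m) d =
      ⊃-trans (boxedConjunct-⊃ X (boxedPart L) (lem₀ {ProvedBoxHere X})) (boxedPart-⊃ L m d)

    □-witness : ∀ {ψ} → Consistent ⟨ v ⟩ → □ ψ ∈ Φ⁺ → ¬ (⟨ v ⟩ ⊩ □ ψ) → Σ Type λ u → v ≺ u × (⟨ u ⟩ ⊩ ¬' ψ)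
    □-witness {ψ} kv mψ ¬□ψ =
        u , (kv , consistent-right ku , inherits , (ψ , mψ , forced ku c⊃□ψ (type-decides Φ⁺ mψ u) , ¬□ψ))
          , forced ku c⊃¬ψ (decides-¬ (decides-body u mψ))
      where
      G : Fm
      G = boxedPart Φ⁺
      c : Fm
      c = (G ∧' □ ψ) ∧' ¬' ψ
      c-consistent : Consistent c
      c-consistent d = ¬□ψ (⊩löb (⊩mp (□-mono (mpTaut d (tautology (G ∷ □ ψ ∷ ψ ∷ [])
          ((((#0 ∧p #1) ∧p ¬p #2) ⊃p ⊥p) ⊃p (#0 ⊃p (#1 ⊃p #2)))))) (boxedPart-□ Φ⁺)))
      extension : Σ Type λ u → Consistent (c ∧' ⟨ u ⟩)
      extension = lindenbaum Φ⁺ c c-consistent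
      u : Type
      u = proj₁ extension
      ku : Consistent (c ∧' ⟨ u ⟩)
      ku = proj₂ extension
      c⊃□ψ : Λ ⊢ c ⊃ □ ψ
      c⊃□ψ = ⊢taut (tautology (G ∷ □ ψ ∷ ψ ∷ []) (((#0 ∧p #1) ∧p ¬p #2) ⊃p #1))
      c⊃¬ψ : Λ ⊢ c ⊃ ¬' ψ
      c⊃¬ψ = ⊢taut (tautology (G ∷ □ ψ ∷ ψ ∷ []) (((#0 ∧p #1) ∧p ¬p #2) ⊃p ¬p #2))
      c⊃G : Λ ⊢ c ⊃ G
      c⊃G = ⊢taut (tautology (G ∷ □ ψ ∷ ψ ∷ []) (((#0 ∧p #1) ∧p ¬p #2) ⊃p #0))
      inherits : Inherits v u
      inherits φ m e =
          forced ku (⊃-trans c⊃G (⊃-trans (boxedPart-⊃ Φ⁺ m e) (⊢taut (tautology (φ ∷ □ φ ∷ []) ((#0 ∧p #1) ⊃p #0)))))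
                 (decides-body u m)
        , forced ku (⊃-trans c⊃G (⊃-trans (boxedPart-⊃ Φ⁺ m e) (⊢taut (tautology (φ ∷ □ φ ∷ []) ((#0 ∧p #1) ⊃p #1)))))
                 (type-decides Φ⁺ m u)

  -- The canonical frame.  Worlds are codes of types; inconsistent types are
  -- worlds too, but they are isolated (R and S only relate consistent ones).
  World : Set
  World = Fin (pow2 k)

  typeOf : World → Type
  typeOf = decodeVec k

  infix 4 _∋_
  _∋_ : World → Fm → Set
  w ∋ X = ⟨ typeOf w ⟩ ⊩ X

  Coherent : World → Set
  Coherent w = Consistent ⟨ typeOf w ⟩

  record _⊏_ (x y : World) : Set where
    constructor mk⊏
    field types≺ : typeOf x ≺ typeOf y
  open _⊏_

  ⊏-trans : ∀ {x y z} → x ⊏ y → y ⊏ z → x ⊏ z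
  ⊏-trans (mk⊏ a) (mk⊏ b) = mk⊏ (≺-trans a b)

  ⊏-coherent : ∀ {x y} → x ⊏ y → Coherent y
  ⊏-coherent r = proj₁ (proj₂ (types≺ r))

  ⊏-inherits : ∀ {x y} → x ⊏ y → ∀ ψ → □ ψ ∈ Φ⁺ → x ∋ □ ψ → (y ∋ ψ) × (y ∋ □ ψ)
  ⊏-inherits r = proj₁ (proj₂ (proj₂ (types≺ r)))

  ⊏-cwf : WellFounded (λ y x → x ⊏ y)
  ⊏-cwf = Subrelation.wellFounded {_<₁_ = λ y x → x ⊏ y} {_<₂_ = λ y x → unprovedBoxes (typeOf y) < unprovedBoxes (typeOf x)}
            (λ r → ≺-decreases (types≺ r)) (On.wellFounded (λ w → unprovedBoxes (typeOf w)) <-wellFounded)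

  decides-Φ₀ʷ : ∀ {X} w → X ∈ Φ₀ → Decides ⟨ typeOf w ⟩ X
  decides-Φ₀ʷ w = decides-Φ₀ (typeOf w)

  TypeRealizes : Fm → Type → Set
  TypeRealizes c v = Consistent ⟨ v ⟩ × (∀ {Z} → Λ ⊢ c ⊃ Z → Decides ⟨ v ⟩ Z → ⟨ v ⟩ ⊩ Z)

  Realizes : Fm → World → Set
  Realizes c w = TypeRealizes c (typeOf w)

  lindenbaum-world : ∀ c → Consistent c → Σ World (Realizes c)
  lindenbaum-world c kc with lindenbaum Φ⁺ c kc
  ... | (u , ku) = encodeVec k u , subst (TypeRealizes c) (sym (decode-encode k u)) (consistent-right ku , forced ku)

  □-witnessʷ : ∀ {ψ} x → Coherent x → □ ψ ∈ Φ⁺ → ¬ (x ∋ □ ψ) → Σ World λ w → x ⊏ w × (w ∋ ¬' ψ)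
  □-witnessʷ {ψ} x kx m ¬□ψ =
    encodeVec k u , mk⊏ (subst (typeOf x ≺_) (sym decoded) x≺u) , subst (λ v → ⟨ v ⟩ ⊩ ¬' ψ) (sym decoded) u¬ψ
    where
    witness : Σ Type λ u → typeOf x ≺ u × (⟨ u ⟩ ⊩ ¬' ψ)
    witness = BoxWitness.□-witness (typeOf x) kx m ¬□ψ
    u : Type
    u = proj₁ witness
    x≺u : typeOf x ≺ u
    x≺u = proj₁ (proj₂ witness)
    u¬ψ : ⟨ u ⟩ ⊩ ¬' ψ
    u¬ψ = proj₂ (proj₂ witness)
    decoded : typeOf (encodeVec k u) ≡ u
    decoded = decode-encode k u

  -- The worlds that an S-set justified by x ⊢ φ ▷ ⋁s has to contain:
  -- coherent worlds proving ⋁s (and, in presence of J4₊, seen from x).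
  InScope : World → Sel₀ → World → Set
  InScope x s w = Coherent w × (w ∋ ⋁₀ s) × (J4+ ∈ Λ → x ⊏ w)

  successor-inScope : ∀ {x z} s → x ⊏ z → z ∋ ⋁₀ s → InScope x s z
  successor-inScope s rz zs = ⊏-coherent rz , zs , λ _ → rz

  record ▷Reason (x y : World) (V : Subset World) : Set where
    constructor mk▷Reason
    field
      antecedent   : Fm
      antecedent∈  : antecedent ∈ Φ₀
      target       : Sel₀
      x∋▷          : x ∋ antecedent ▷ ⋁₀ target
      y∋antecedent : y ∋ antecedent
      covers       : ∀ w → InScope x target w → V w
      reachable    : Σ World λ w → x ⊏ w × (w ∋ ⋁₀ target)

  data SReason (x y : World) (V : Subset World) : Set where
    by▷  : ▷Reason x y V → SReason x y V
    byJ1 : J1 ∈ Λ → V y → SReason x y V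
    byJ5 : J5 ∈ Λ → ∀ {w} → y ⊏ w → V w → SReason x y V

  Sᶜ : World → World → Subset World → Set
  Sᶜ x y V = x ⊏ y × Σ World V × SReason x y V

  SReason-mono : ∀ {x y V U} → SReason x y V → V ⊆ U → SReason x y U
  SReason-mono (by▷ (mk▷Reason φ mφ s d yφ cov ne)) h = by▷ (mk▷Reason φ mφ s d yφ (λ w i → h w (cov w i)) ne)
  SReason-mono (byJ1 j vy) h = byJ1 j (h _ vy)
  SReason-mono (byJ5 j r vw) h = byJ5 j r (h _ vw)

  Sᶜ-mono : ∀ {x y V U} → Sᶜ x y V → V ⊆ U → Sᶜ x y U
  Sᶜ-mono (r , (z , vz) , why) h = r , (z , h z vz) , SReason-mono why h

  canonicalFrame : ILSFrame
  canonicalFrame = record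
    { W = World ; point = encodeVec k (replicate k false) ; R = _⊏_ ; S = Sᶜ
    ; R-trans = ⊏-trans ; R-cwf = ⊏-cwf ; S-R = proj₁ ; S-nonempty = λ s → proj₁ (proj₂ s)
    ; S-mono = Sᶜ-mono }

  canonicalFrame-finite : Finite canonicalFrame
  canonicalFrame-finite = pow2 k , ↔-refl

  canonicalVal : World → ℕ → Set
  canonicalVal w p = w ∋ var p

  infix 4 _⊨_
  _⊨_ : World → Fm → Set₁
  w ⊨ X = Sat canonicalFrame canonicalVal w X

  just : Fm → Sel₀
  just X = selection Φ₀ (_≡ X)

  just-intro : ∀ {X} → X ∈ Φ₀ → Λ ⊢ X ⊃ ⋁₀ (just X)
  just-intro m = ⋁-intro (selection⁺ m refl)

  just-elim : ∀ {X} → Λ ⊢ ⋁₀ (just X) ⊃ X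
  just-elim {X} = ⋁-elim {L = Φ₀} (λ Y p → subst (λ Z → Λ ⊢ Y ⊃ Z) (selection⁻ {L = Φ₀} {P = _≡ X} p) ⊩refl)

  none : Sel₀
  none = selection Φ₀ (λ _ → Empty)

  none-elim : Λ ⊢ ⋁₀ none ⊃ ⊥'
  none-elim = ⋁-elim {L = Φ₀} (λ Y p → ⊥-elim (selection⁻ {L = Φ₀} {P = λ _ → Empty} p))

  □⊃-witness : ∀ x s t → Coherent x → ¬ (x ∋ □⊃ s t) →
               Σ World λ w → x ⊏ w × (w ∋ ⋁₀ s) × (w ∋ ¬' ⋁₀ t)
  □⊃-witness x s t kx ¬□ = split (□-witnessʷ x kx (□⊃∈Φ⁺ s t) ¬□)
    where
    split : Σ World (λ w → x ⊏ w × (w ∋ ¬' (⋁₀ s ⊃ ⋁₀ t))) → Σ World λ w → x ⊏ w × (w ∋ ⋁₀ s) × (w ∋ ¬' ⋁₀ t)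
    split (w , r , w¬⊃) = w , r , ⊩¬⊃-antecedent w¬⊃ , ⊩¬⊃-consequent w¬⊃

  ⊩▷-□¬ : ∀ {c X Y} → c ⊩ X ▷ Y → c ⊩ □ (¬' Y) → c ⊩ □ (¬' X)
  ⊩▷-□¬ {X = X} {Y} = ⊩mp2 (mpTaut (J4-derivable X Y)
    (tautology (X ▷ Y ∷ □ (¬' X) ∷ □ (¬' Y) ∷ []) ((#0 ⊃p (¬p #1 ⊃p ¬p #2)) ⊃p #0 ⊃p #2 ⊃p #1)))

  -- If x ⊢ φ ▷ ⋁s and a successor of x proves φ, some successor proves ⋁s.
  -- Otherwise x ⊢ □¬⋁s, so x ⊢ □¬φ by J4, which the successor refutes.
  ▷-reachable : ∀ {x y φ s} → Coherent x → φ ∈ Φ₀ → x ∋ φ ▷ ⋁₀ s → x ⊏ y → y ∋ φ →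
                Σ World λ z → x ⊏ z × (z ∋ ⋁₀ s)
  ▷-reachable {x} {y} {φ} {s} kx mφ x▷ r yφ = forget¬ (□⊃-witness x s none kx ¬□[s⊃∅])
    where
    ¬□[φ⊃∅] : ¬ (x ∋ □⊃ (just φ) none)
    ¬□[φ⊃∅] e = ⊏-coherent r (⊩mp none-elim (⊩app (proj₁ (⊏-inherits r _ (□⊃∈Φ⁺ (just φ) none) e)) (⊩mp (just-intro mφ) yφ)))
    ¬□[s⊃∅] : ¬ (x ∋ □⊃ s none)
    ¬□[s⊃∅] e = ¬□[φ⊃∅] (⊩□-mono (mpTaut just-elim (tautology (⋁₀ (just φ) ∷ φ ∷ ⋁₀ none ∷ [])
                   ((#0 ⊃p #1) ⊃p (¬p #1 ⊃p (#0 ⊃p #2))))) (⊩▷-□¬ x▷ □¬⋁s))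
      where
      □¬⋁s : x ∋ □ (¬' ⋁₀ s)
      □¬⋁s = ⊩□-mono (mpTaut none-elim (tautology (⋁₀ s ∷ ⋁₀ none ∷ []) ((#1 ⊃p ⊥p) ⊃p ((#0 ⊃p #1) ⊃p ¬p #0)))) e
    forget¬ : Σ World (λ z → x ⊏ z × (z ∋ ⋁₀ s) × (z ∋ ¬' ⋁₀ none)) → Σ World λ z → x ⊏ z × (z ∋ ⋁₀ s)
    forget¬ (z , rz , zs , _) = z , rz , zs

  TruthFor : Fm → Set₁
  TruthFor X = ∀ w → Coherent w → (w ⊨ X → w ∋ X) × (w ∋ X → w ⊨ X)

  -- A proved B ▷ C is satisfied: for y ⊨ B take the scope of {C}, which is
  -- an S-set by B ▷ ⋁{C} and consists of C-worlds.
  ▷-true : ∀ {B C} → B ∈ Φ₀ → C ∈ Φ₀ → TruthFor B → TruthFor C → ∀ x → Coherent x → x ∋ B ▷ C → x ⊨ B ▷ C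
  ▷-true {B} {C} mB mC tB tC x kx x▷ y r y⊨B = S-set (▷-reachable {s = just C} kx mB x▷' r yB)
    where
    x▷' : x ∋ B ▷ ⋁₀ (just C)
    x▷' = ⊩r1 (just-intro mC) x▷
    yB : y ∋ B
    yB = proj₁ (tB y (⊏-coherent r)) y⊨B
    S-set : Σ World (λ z → x ⊏ z × (z ∋ ⋁₀ (just C))) → Σ (Subset World) λ V → Sᶜ x y V × (∀ z → V z → z ⊨ C)
    S-set (z , rz , zC) =
        InScope x (just C)
      , (r , (z , successor-inScope (just C) rz zC) , by▷ (mk▷Reason B mB (just C) x▷' yB (λ w i → i) (z , rz , zC)))
      , λ w i → proj₂ (tC w (proj₁ i)) (⊩mp just-elim (proj₁ (proj₂ i)))

  -- Call φ ∈ Φ₀ acceptable if x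
  -- reduces it to C: either x ⊢ φ ▷ ⋁s for an s whose scope has no ¬C-world,
  -- or φ = C (with J1), or φ = ◇C (with J5).  Each acceptable φ satisfies
  -- x ⊢ φ ▷ C, hence so does their disjunction; as x ⊬ B ▷ C, x ⊬ □(B ⊃ ⋁acc),
  -- so a successor y proves B and no acceptable formula, and no S-set of
  -- y over x consists of C-worlds.
  module ▷Refutation {B C : Fm} (mB : B ∈ Φ₀) (mC : C ∈ Φ₀) (m◇C : ◇ C ∈ Φ₀) (tB : TruthFor B) (tC : TruthFor C)
                     (x : World) (kx : Coherent x) (x⊬B▷C : ¬ (x ∋ B ▷ C)) where

    ScopeRefutesC : Sel₀ → Set
    ScopeRefutesC s = Σ World λ z → InScope x s z × (z ∋ ¬' C)

    ReducedToC : Fm → Set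
    ReducedToC φ = Σ Sel₀ λ s → (x ∋ φ ▷ ⋁₀ s) × ¬ ScopeRefutesC s

    Acceptable : Fm → Set
    Acceptable φ = (J1 ∈ Λ × φ ≡ C) ⊎ (J5 ∈ Λ × φ ≡ ◇ C) ⊎ ReducedToC φ

    acceptable : Sel₀
    acceptable = selection Φ₀ Acceptable

    -- With J4₊: x ⊢ □(⋁s ⊃ C), since a successor refuting it would be a
    -- ¬C-world in the scope of s; then J4₊ moves φ ▷ ⋁s to φ ▷ C.
    reduced-▷C-J4+ : ∀ {φ} s → x ∋ φ ▷ ⋁₀ s → ¬ ScopeRefutesC s → J4+ ∈ Λ → Dec (x ∋ □⊃ s (just C)) → x ∋ φ ▷ C
    reduced-▷C-J4+ {φ} s x▷ ¬ref j (yes □s⊃C) =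
      ⊩app (⊩app (⊩schema j (j4+ (⋁₀ s) C φ))
        (⊩□-mono (mpTaut just-elim (tautology (⋁₀ s ∷ ⋁₀ (just C) ∷ C ∷ []) ((#1 ⊃p #2) ⊃p ((#0 ⊃p #1) ⊃p (#0 ⊃p #2))))) □s⊃C)) x▷
    reduced-▷C-J4+ s x▷ ¬ref j (no ¬□) = ⊥-elim (¬ref (refuter (□⊃-witness x s (just C) kx ¬□)))
      where
      refuter : Σ World (λ z → x ⊏ z × (z ∋ ⋁₀ s) × (z ∋ ¬' ⋁₀ (just C))) → ScopeRefutesC s
      refuter (z , rz , zs , z¬C) =
        z , successor-inScope s rz zs ,
        ⊩taut2 (tautology (⋁₀ (just C) ∷ C ∷ []) ((#1 ⊃p #0) ⊃p ¬p #0 ⊃p ¬p #1)) (⊩thm (just-intro mC)) z¬C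

    -- Without J4₊: ⋁s ∧ ¬C is inconsistent, since a world extending it
    -- would lie in the scope of s; then R1 moves φ ▷ ⋁s to φ ▷ C.
    reduced-▷C-noJ4+ : ∀ {φ} s → x ∋ φ ▷ ⋁₀ s → ¬ ScopeRefutesC s → ¬ (J4+ ∈ Λ) →
                       Dec (Λ ⊢ (⋁₀ s ∧' ¬' C) ⊃ ⊥') → x ∋ φ ▷ C
    reduced-▷C-noJ4+ s x▷ ¬ref nj (yes inc) =
      ⊩r1 (mpTaut inc (tautology (⋁₀ s ∷ C ∷ []) (((#0 ∧p ¬p #1) ⊃p ⊥p) ⊃p (#0 ⊃p #1)))) x▷
    reduced-▷C-noJ4+ s x▷ ¬ref nj (no cons) = ⊥-elim (¬ref (refuter (lindenbaum-world (⋁₀ s ∧' ¬' C) cons)))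
      where
      refuter : Σ World (Realizes (⋁₀ s ∧' ¬' C)) → ScopeRefutesC s
      refuter (z , kz , proves) =
          z
        , (kz , proves (⊢taut (tautology (⋁₀ s ∷ C ∷ []) ((#0 ∧p ¬p #1) ⊃p #0))) (decides-⋁₀ (typeOf z) s) , λ j → ⊥-elim (nj j))
        , proves (⊢taut (tautology (⋁₀ s ∷ C ∷ []) ((#0 ∧p ¬p #1) ⊃p ¬p #1))) (decides-¬ (decides-Φ₀ʷ z mC))

    acceptable-▷C : ∀ φ → Acceptable φ → x ∋ φ ▷ C
    acceptable-▷C φ (inj₁ (j , refl)) = ⊩app (⊩schema j (j1 C C)) (⊩thm (nec (⊢taut (tautology (C ∷ []) (#0 ⊃p #0)))))
    acceptable-▷C φ (inj₂ (inj₁ (j , refl))) = ⊩schema j (j5 C)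
    acceptable-▷C φ (inj₂ (inj₂ (s , x▷ , ¬ref))) = byJ4+ (lem₀ {J4+ ∈ Λ})
      where
      byJ4+ : Dec (J4+ ∈ Λ) → x ∋ φ ▷ C
      byJ4+ (yes j) = reduced-▷C-J4+ s x▷ ¬ref j (lem₀ {x ∋ □⊃ s (just C)})
      byJ4+ (no nj) = reduced-▷C-noJ4+ s x▷ ¬ref nj (lem₀ {Λ ⊢ (⋁₀ s ∧' ¬' C) ⊃ ⊥'})

    ¬□[B⊃acceptable] : ¬ (x ∋ □⊃ (just B) acceptable)
    ¬□[B⊃acceptable] e =
      x⊬B▷C (⊩r2 (just-intro mB) (⊩□⊃▷ e (⋁-▷ {L = Φ₀} (λ φ p → acceptable-▷C φ (selection⁻ {L = Φ₀} {P = Acceptable} p)))))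

    ¬⊨C : ∀ z → Coherent z → z ∋ ¬' C → ¬ (z ⊨ C)
    ¬⊨C z kz z¬C z⊨C = contradiction kz (proj₁ (tC z kz) z⊨C) z¬C

    module _ (y : World) (r : x ⊏ y) (y¬acc : y ∋ ¬' ⋁₀ acceptable) where
      ky : Coherent y
      ky = ⊏-coherent r

      ¬acceptable : ∀ {φ} → φ ∈ Φ₀ → y ∋ φ → ¬ Acceptable φ
      ¬acceptable m yφ accφ = contradiction ky (⊩mp (⋁-intro (selection⁺ {P = Acceptable} m accφ)) yφ) y¬acc

      no-C-set : ∀ {V} → SReason x y V → ¬ (∀ z → V z → z ⊨ C)
      no-C-set (by▷ (mk▷Reason φ mφ s x▷ yφ covers _)) V⊨C = byScope (lem₀ {ScopeRefutesC s})
        where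
        byScope : Dec (ScopeRefutesC s) → Empty
        byScope (yes (z , inScope , z¬C)) = ¬⊨C z (proj₁ inScope) z¬C (V⊨C z (covers z inScope))
        byScope (no ¬ref) = ¬acceptable mφ yφ (inj₂ (inj₂ (s , x▷ , ¬ref)))
      no-C-set (byJ1 j Vy) V⊨C = byC (decides-Φ₀ʷ y mC)
        where
        byC : Decides ⟨ typeOf y ⟩ C → Empty
        byC (inj₁ yC)  = ¬acceptable mC yC (inj₁ (j , refl))
        byC (inj₂ y¬C) = ¬⊨C y ky y¬C (V⊨C y Vy)
      no-C-set (byJ5 j {w} ryw Vw) V⊨C = by◇C (decides-Φ₀ʷ y m◇C)
        where
        □¬C∈Φ⁺ : □ (¬' C) ∈ Φ⁺
        □¬C∈Φ⁺ = Φ₀⊆Φ⁺ (sub-trans (A ∧' ◇consequents (sub A)) m◇C (there (here refl)))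
        by◇C : Decides ⟨ typeOf y ⟩ (◇ C) → Empty
        by◇C (inj₁ y◇C)  = ¬acceptable m◇C y◇C (inj₂ (inj₁ (j , refl)))
        by◇C (inj₂ y¬◇C) = ¬⊨C w (⊏-coherent ryw) (proj₁ (⊏-inherits ryw (¬' C) □¬C∈Φ⁺ y□¬C)) (V⊨C w Vw)
          where
          y□¬C : y ∋ □ (¬' C)
          y□¬C = ⊩taut (tautology (□ (¬' C) ∷ []) (¬p (¬p #0) ⊃p #0)) y¬◇C

    ▷-refuted : ¬ (x ⊨ B ▷ C)
    ▷-refuted x⊨B▷C = refute (□⊃-witness x (just B) acceptable kx ¬□[B⊃acceptable])
      where
      refute : Σ World (λ y → x ⊏ y × (y ∋ ⋁₀ (just B)) × (y ∋ ¬' ⋁₀ acceptable)) → Empty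
      refute (y , r , yB , y¬acc) = noSet (x⊨B▷C y r (proj₂ (tB y (⊏-coherent r)) (⊩mp just-elim yB)))
        where
        noSet : Σ (Subset World) (λ V → Sᶜ x y V × (∀ z → V z → z ⊨ C)) → Empty
        noSet (V , (_ , _ , why) , V⊨C) = no-C-set y r y¬acc why V⊨C

  Decided : Fm → Set
  Decided X = ∀ w → Decides ⟨ typeOf w ⟩ X

  truth-¬ : ∀ {X} → Decided X → TruthFor X → TruthFor (¬' X)
  truth-¬ dX tX w kw =
      (λ ¬sat → decides-¬-of-not (dX w) (λ d → ¬sat (proj₂ (tX w kw) d)))
    , (λ d sat → contradiction kw (proj₁ (tX w kw) sat) d)

  truth-∧ : ∀ {X Y} → TruthFor X → TruthFor Y → TruthFor (X ∧' Y)
  truth-∧ {X} {Y} tX tY w kw =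
      (λ { (sX , sY) → ⊩taut2 (tautology (X ∷ Y ∷ []) (#0 ⊃p #1 ⊃p (#0 ∧p #1))) (proj₁ (tX w kw) sX) (proj₁ (tY w kw) sY) })
    , (λ d → proj₂ (tX w kw) (⊩taut (tautology (X ∷ Y ∷ []) ((#0 ∧p #1) ⊃p #0)) d)
           , proj₂ (tY w kw) (⊩taut (tautology (X ∷ Y ∷ []) ((#0 ∧p #1) ⊃p #1)) d))

  truth-∨ : ∀ {X Y} → Decided X → TruthFor X → TruthFor Y → TruthFor (X ∨' Y)
  truth-∨ {X} {Y} dX tX tY w kw = satisfied⇒proved , proved⇒satisfied (dX w)
    where
    satisfied⇒proved : w ⊨ X ∨' Y → w ∋ X ∨' Y
    satisfied⇒proved (inj₁ s) = ⊩taut (tautology (X ∷ Y ∷ []) (#0 ⊃p (#0 ∨p #1))) (proj₁ (tX w kw) s)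
    satisfied⇒proved (inj₂ s) = ⊩taut (tautology (X ∷ Y ∷ []) (#1 ⊃p (#0 ∨p #1))) (proj₁ (tY w kw) s)
    proved⇒satisfied : Decides ⟨ typeOf w ⟩ X → w ∋ X ∨' Y → w ⊨ X ∨' Y
    proved⇒satisfied (inj₁ wX)  d = inj₁ (proj₂ (tX w kw) wX)
    proved⇒satisfied (inj₂ w¬X) d = inj₂ (proj₂ (tY w kw) (⊩taut2 (tautology (X ∷ Y ∷ []) ((#0 ∨p #1) ⊃p ¬p #0 ⊃p #1)) d w¬X))

  truth-⊃ : ∀ {X Y} → Decided X → TruthFor X → TruthFor Y → TruthFor (X ⊃ Y)
  truth-⊃ {X} {Y} dX tX tY w kw = satisfied⇒proved (dX w) , proved⇒satisfied
    where
    satisfied⇒proved : Decides ⟨ typeOf w ⟩ X → w ⊨ X ⊃ Y → w ∋ X ⊃ Y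
    satisfied⇒proved (inj₁ wX)  s = ⊩taut (tautology (X ∷ Y ∷ []) (#1 ⊃p (#0 ⊃p #1))) (proj₁ (tY w kw) (s (proj₂ (tX w kw) wX)))
    satisfied⇒proved (inj₂ w¬X) s = ⊩taut (tautology (X ∷ Y ∷ []) (¬p #0 ⊃p (#0 ⊃p #1))) w¬X
    proved⇒satisfied : w ∋ X ⊃ Y → w ⊨ X ⊃ Y
    proved⇒satisfied d s = proj₂ (tY w kw) (⊩app d (proj₁ (tX w kw) s))

  truth-□ : ∀ {X} → □ X ∈ Φ⁺ → Decided (□ X) → TruthFor X → TruthFor (□ X)
  truth-□ {X} m d□X tX w kw = satisfied⇒proved (d□X w) , proved⇒satisfied
    where
    satisfied⇒proved : Decides ⟨ typeOf w ⟩ (□ X) → w ⊨ □ X → w ∋ □ X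
    satisfied⇒proved (inj₁ w□X)  s = w□X
    satisfied⇒proved (inj₂ w¬□X) s = ⊥-elim (refute (□-witnessʷ w kw m (λ d → contradiction kw d w¬□X)))
      where
      refute : Σ World (λ z → w ⊏ z × (z ∋ ¬' X)) → Empty
      refute (z , r , z¬X) = contradiction (⊏-coherent r) (proj₁ (tX z (⊏-coherent r)) (s z r)) z¬X
    proved⇒satisfied : w ∋ □ X → w ⊨ □ X
    proved⇒satisfied d z r = proj₂ (tX z (⊏-coherent r)) (proj₁ (⊏-inherits r X m d))

  truth-▷ : ∀ {B C} → B ∈ Φ₀ → C ∈ Φ₀ → ◇ C ∈ Φ₀ → Decided (B ▷ C) → TruthFor B → TruthFor C → TruthFor (B ▷ C)
  truth-▷ {B} {C} mB mC m◇C d▷ tB tC w kw = satisfied⇒proved (d▷ w) , ▷-true mB mC tB tC w kw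
    where
    satisfied⇒proved : Decides ⟨ typeOf w ⟩ (B ▷ C) → w ⊨ B ▷ C → w ∋ B ▷ C
    satisfied⇒proved (inj₁ w▷)  s = w▷
    satisfied⇒proved (inj₂ w¬▷) s = ⊥-elim (▷Refutation.▷-refuted mB mC m◇C tB tC w kw (λ d → contradiction kw d w¬▷) s)

  sub-left : ∀ {Z X Y} → Z ∈ sub A → properSub Z ≡ sub X ++ sub Y → X ∈ sub A
  sub-left {X = X} {Y} m eq = sub-trans A m (there (subst (X ∈_) (sym eq) (∈-++⁺ˡ {xs = sub X} {ys = sub Y} (here refl))))

  sub-right : ∀ {Z X Y} → Z ∈ sub A → properSub Z ≡ sub X ++ sub Y → Y ∈ sub A
  sub-right {X = X} {Y} m eq = sub-trans A m (there (subst (Y ∈_) (sym eq) (∈-++⁺ʳ (sub X) (here refl))))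

  sub-body : ∀ {Z X} → Z ∈ sub A → properSub Z ≡ sub X → X ∈ sub A
  sub-body {X = X} m eq = sub-trans A m (there (subst (X ∈_) (sym eq) (here refl)))

  decided : ∀ {X} → X ∈ sub A → Decided X
  decided m w = decides-Φ₀ʷ w (sub-A⊆Φ₀ m)

  truth : ∀ X → X ∈ sub A → TruthFor X
  truth (var p)  m w kw = (λ { (lift d) → d }) , lift
  truth ⊤'       m w kw = (λ _ → ⊩thm (⊢taut (tautology [] ⊤p))) , (λ _ → lift tt)
  truth ⊥'       m w kw = (λ { (lift ()) }) , (λ d → ⊥-elim (kw d))
  truth (¬' X)   m = truth-¬ (decided (sub-body m refl)) (truth X (sub-body m refl))
  truth (X ∧' Y) m = truth-∧ (truth X (sub-left m refl)) (truth Y (sub-right m refl))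
  truth (X ∨' Y) m = truth-∨ (decided (sub-left m refl)) (truth X (sub-left m refl)) (truth Y (sub-right m refl))
  truth (X ⊃ Y)  m = truth-⊃ (decided (sub-left m refl)) (truth X (sub-left m refl)) (truth Y (sub-right m refl))
  truth (□ X)    m = truth-□ (Φ₀⊆Φ⁺ (sub-A⊆Φ₀ m)) (decided m) (truth X (sub-body m refl))
  truth (B ▷ C)  m = truth-▷ (sub-A⊆Φ₀ (sub-left m refl)) (sub-A⊆Φ₀ (sub-right m refl)) (◇C∈Φ₀ m) (decided m)
                             (truth B (sub-left m refl)) (truth C (sub-right m refl))

  -- Frame conditions: every schema of Λ is valid in the canonical frame.
  -- All of them rely on: each S-set of y over x contains an R-successor of x.
  S-successor : ∀ {x y V} → Sᶜ x y V → Σ World λ z → V z × x ⊏ z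
  S-successor (r , _ , by▷ (mk▷Reason _ _ s _ _ covers (z , rz , zs))) = z , covers z (successor-inScope s rz zs) , rz
  S-successor {y = y} (r , _ , byJ1 _ Vy) = y , Vy , r
  S-successor (r , _ , byJ5 _ {w} ryw Vw) = w , Vw , ⊏-trans r ryw

  J4-valid : ∀ X Y → ValidIn canonicalFrame (X ▷ Y ⊃ (◇ X ⊃ ◇ Y))
  J4-valid X Y val x x▷ ◇X ¬◇Y with lem₁ {Σ World λ y → x ⊏ y × Sat canonicalFrame val y X}
  ... | no ¬X = ◇X (λ y r yX → ¬X (y , r , yX))
  ... | yes (y , r , yX) with x▷ y r yX
  ...   | (V , ySV , V⊨Y) with S-successor ySV
  ...     | (z , Vz , rz) = ¬◇Y z rz (V⊨Y z Vz)

  J1-valid : J1 ∈ Λ → ∀ X Y → ValidIn canonicalFrame (□ (X ⊃ Y) ⊃ X ▷ Y)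
  J1-valid j X Y val x □X⊃Y y r yX =
    (_≡ y) , (r , (y , refl) , byJ1 j refl) , λ { z refl → □X⊃Y y r yX }

  J5-valid : J5 ∈ Λ → ∀ X → ValidIn canonicalFrame ((◇ X) ▷ X)
  J5-valid j X val x y r y◇X with lem₁ {Σ World λ z → y ⊏ z × Sat canonicalFrame val z X}
  ... | yes (z , ryz , zX) = (_≡ z) , (r , (z , refl) , byJ5 j ryz refl) , λ { u refl → zX }
  ... | no ¬X = ⊥-elim (y◇X (λ z ryz zX → ¬X (z , ryz , zX)))

  S-restrict : J4+ ∈ Λ → ∀ {x y V} → Sᶜ x y V → Sᶜ x y (λ w → V w × x ⊏ w)
  S-restrict j {x} {y} {V} ySV@(r , _ , why) = r , S-successor ySV , restrict why
    where
    restrict : SReason x y V → SReason x y (λ w → V w × x ⊏ w)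
    restrict (by▷ (mk▷Reason φ mφ s x▷ yφ covers reach)) =
      by▷ (mk▷Reason φ mφ s x▷ yφ (λ w i → covers w i , proj₂ (proj₂ i) j) reach)
    restrict (byJ1 j' Vy) = byJ1 j' (Vy , r)
    restrict (byJ5 j' ryw Vw) = byJ5 j' ryw (Vw , ⊏-trans r ryw)

  J4+-valid : J4+ ∈ Λ → ∀ X Y Z → ValidIn canonicalFrame (□ (X ⊃ Y) ⊃ (Z ▷ X ⊃ Z ▷ Y))
  J4+-valid j X Y Z val x □X⊃Y x▷ y r yZ with x▷ y r yZ
  ... | (V , ySV , V⊨X) = (λ w → V w × x ⊏ w) , S-restrict j ySV , λ { w (Vw , rw) → □X⊃Y w rw (V⊨X w Vw) }

  -- Under J2 (hence without J1, J5) every S-reason is a ▷-reason.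
  ▷Reason-only : J2 ∈ Λ → ∀ {x y V} → SReason x y V → ▷Reason x y V
  ▷Reason-only j (by▷ why)        = why
  ▷Reason-only j (byJ1 inJ1 _)   = ⊥-elim (proj₁ (J2-alone j) inJ1)
  ▷Reason-only j (byJ5 inJ5 _ _) = ⊥-elim (proj₂ (J2-alone j) inJ5)

  -- Let y S_x V (by x ⊢ φ ▷ ⋁s) with V ⊨ Y, and x ⊨ Y ▷ Z.  Every
  -- successor θ of x in the scope of s lies in V, so θ S_x U_θ ⊨ Z by some
  -- x ⊢ φ_θ ▷ ⋁s_θ.  Let e = {φ_θ} and s'' = ⋃ s_θ.  Then x ⊢ □(⋁s ⊃ ⋁e) and
  -- x ⊢ ⋁e ▷ ⋁s'', so x ⊢ φ ▷ ⋁s'' by J2, which justifies y S_x ⋃ U_θ.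
  module J2Validity (j : J2 ∈ Λ) (val : World → ℕ → Set) (x : World) (Y Z : Fm)
                    (x⊨Y▷Z : Sat canonicalFrame val x (Y ▷ Z)) (y : World) (r : x ⊏ y) {V : Subset World}
                    (why : ▷Reason x y V) (V⊨Y : ∀ w → V w → Sat canonicalFrame val w Y) where
    open ▷Reason why

    kx : Coherent x
    kx = proj₁ (types≺ r)

    Successor : Set
    Successor = Σ World λ θ → InScope x target θ × x ⊏ θ

    toSuccessor : Σ World (λ w → x ⊏ w × (w ∋ ⋁₀ target)) → Successor
    toSuccessor (θ , rθ , θs) = θ , successor-inScope target rθ θs , rθ

    S-set : (θ : Successor) → Σ (Subset World) λ U → Sᶜ x (proj₁ θ) U × (∀ w → U w → Sat canonicalFrame val w Z)
    S-set (θ , inScope , rθ) = x⊨Y▷Z θ rθ (V⊨Y θ (covers θ inScope))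

    Uᶿ : Successor → Subset World
    Uᶿ θ = proj₁ (S-set θ)

    reason : (θ : Successor) → ▷Reason x (proj₁ θ) (Uᶿ θ)
    reason θ = ▷Reason-only j (proj₂ (proj₂ (proj₁ (proj₂ (S-set θ)))))

    Antecedent : Fm → Set
    Antecedent φ' = Σ Successor λ θ → ▷Reason.antecedent (reason θ) ≡ φ'

    e : Sel₀
    e = selection Φ₀ Antecedent

    InSomeTarget : Fm → Set
    InSomeTarget ψ = Σ Successor λ θ → Selected Φ₀ (▷Reason.target (reason θ)) ψ

    s'' : Sel₀
    s'' = selection Φ₀ InSomeTarget

    target⊆s'' : ∀ θ → Λ ⊢ ⋁₀ (▷Reason.target (reason θ)) ⊃ ⋁₀ s''
    target⊆s'' θ = ⋁-elim {L = Φ₀} (λ ψ p → ⋁-intro (selection⁺ {L = Φ₀} {P = InSomeTarget} (selected-∈ p) (θ , p)))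

    -- A successor proving ⋁s but refuting ⋁e would be some θ, which proves φ_θ.
    □[s⊃e] : x ∋ □⊃ target e
    □[s⊃e] = byCases (lem₀ {x ∋ □⊃ target e})
      where
      refute : Σ World (λ θ → x ⊏ θ × (θ ∋ ⋁₀ target) × (θ ∋ ¬' ⋁₀ e)) → Empty
      refute (θ , rθ , θs , θ¬e) = contradiction (⊏-coherent rθ) θe θ¬e
        where
        θ' : Successor
        θ' = toSuccessor (θ , rθ , θs)
        θe : θ ∋ ⋁₀ e
        θe = ⊩mp (⋁-intro (selection⁺ {L = Φ₀} {P = Antecedent} (▷Reason.antecedent∈ (reason θ')) (θ' , refl)))
                 (▷Reason.y∋antecedent (reason θ'))
      byCases : Dec (x ∋ □⊃ target e) → x ∋ □⊃ target e
      byCases (yes d) = d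
      byCases (no ¬□) = ⊥-elim (refute (□⊃-witness x target e kx ¬□))

    e▷s'' : x ∋ ⋁₀ e ▷ ⋁₀ s''
    e▷s'' = ⋁-▷ {L = Φ₀} {s = e} (λ φ' p → fromAntecedent φ' (selection⁻ {L = Φ₀} {P = Antecedent} p))
      where
      fromAntecedent : ∀ φ' → Antecedent φ' → x ∋ φ' ▷ ⋁₀ s''
      fromAntecedent _ (θ , refl) = ⊩r1 (target⊆s'' θ) (▷Reason.x∋▷ (reason θ))

    φ▷s'' : x ∋ antecedent ▷ ⋁₀ s''
    φ▷s'' = ⊩app (⊩schema j (j2 antecedent (⋁₀ target) (⋁₀ s'')))
      (⊩taut2 (tautology (antecedent ▷ ⋁₀ target ∷ ⋁₀ target ▷ ⋁₀ s'' ∷ []) (#0 ⊃p #1 ⊃p (#0 ∧p #1)))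
              x∋▷ (⊩□⊃▷ □[s⊃e] e▷s''))

    U : Subset World
    U w = Σ Successor λ θ → Uᶿ θ w

    covers'' : ∀ w → InScope x s'' w → U w
    covers'' w (kw , ws'' , seen) = fromDisjunct (⋁-witness {L = Φ₀} {s = s''} kw (λ ψ m → decides-Φ₀ʷ w m) ws'')
      where
      fromDisjunct : Σ Fm (λ ψ → Selected Φ₀ s'' ψ × (w ∋ ψ)) → U w
      fromDisjunct (ψ , p , wψ) = fromTarget (selection⁻ {L = Φ₀} {P = InSomeTarget} p)
        where
        fromTarget : InSomeTarget ψ → U w
        fromTarget (θ , q) = θ , ▷Reason.covers (reason θ) w (kw , ⊩mp (⋁-intro q) wψ , seen)

    reachable'' : Σ World λ w → x ⊏ w × (w ∋ ⋁₀ s'')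
    reachable'' = enlarge (▷Reason.reachable (reason θ₀))
      where
      θ₀ : Successor
      θ₀ = toSuccessor reachable
      enlarge : Σ World (λ w → x ⊏ w × (w ∋ ⋁₀ (▷Reason.target (reason θ₀)))) → Σ World λ w → x ⊏ w × (w ∋ ⋁₀ s'')
      enlarge (w₀ , rw₀ , w₀t) = w₀ , rw₀ , ⊩mp (target⊆s'' θ₀) w₀t

    nonempty : Σ World U
    nonempty = inU reachable''
      where
      inU : Σ World (λ w → x ⊏ w × (w ∋ ⋁₀ s'')) → Σ World U
      inU (w₀ , rw₀ , w₀s'') = w₀ , covers'' w₀ (successor-inScope s'' rw₀ w₀s'')

    S-set-for-Z : Σ (Subset World) λ U → Sᶜ x y U × (∀ w → U w → Sat canonicalFrame val w Z)
    S-set-for-Z = U , (r , nonempty , by▷ (mk▷Reason antecedent antecedent∈ s'' φ▷s'' y∋antecedent covers'' reachable''))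
                , λ { w (θ , Uθw) → proj₂ (proj₂ (S-set θ)) w Uθw }

  J2-valid : J2 ∈ Λ → ∀ X Y Z → ValidIn canonicalFrame ((X ▷ Y) ∧' (Y ▷ Z) ⊃ X ▷ Z)
  J2-valid j X Y Z val x (x⊨X▷Y , x⊨Y▷Z) y r yX with x⊨X▷Y y r yX
  ... | (V , (_ , _ , why) , V⊨Y) = J2Validity.S-set-for-Z j val x Y Z x⊨Y▷Z y r (▷Reason-only j why) V⊨Y

  canonicalFrame-LFrame : LFrame Λ canonicalFrame
  canonicalFrame-LFrame = Soundness.LFrame-from-schemata lem₁ canonicalFrame Λ schema-valid
    where
    schema-valid : ∀ {σ X} → σ ∈ Λ → Instance σ X → ValidIn canonicalFrame X
    schema-valid m (j1 X Y)    = J1-valid m X Y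
    schema-valid m (j2 X Y Z)  = J2-valid m X Y Z
    schema-valid m (j4 X Y)    = J4-valid X Y
    schema-valid m (j4+ X Y Z) = J4+-valid m X Y Z
    schema-valid m (j5 X)      = J5-valid m X

  completeness : (∀ F → Finite F → LFrame Λ F → ValidIn F A) → Λ ⊢ A
  completeness valid with lem₀ {Λ ⊢ A}
  ... | yes ⊢A = ⊢A
  ... | no ⊬A  = ⊥-elim (A-fails (lindenbaum-world (¬' A) ¬A-consistent))
    where
    ¬A-consistent : Consistent (¬' A)
    ¬A-consistent d = ⊬A (mpTaut d (tautology (A ∷ []) ((¬p #0 ⊃p ⊥p) ⊃p #0)))
    A-fails : Σ World (Realizes (¬' A)) → Empty
    A-fails (w , kw , proves) =
      contradiction kw
        (proj₁ (truth A (here refl) w kw) (valid canonicalFrame canonicalFrame-finite canonicalFrame-LFrame canonicalVal w))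
        (proves ⊩refl (decides-¬ (decides-Φ₀ʷ w (sub-A⊆Φ₀ (here refl)))))

-- The six logics satisfy the hypotheses of the canonical construction:
-- J4 is derivable in each of them (from J2 via J6 when J4 is not an axiom),
-- and J2 never occurs together with J1 or J5.
J4-from-J2 : ∀ {Λ} → J2 ∈ Λ → ∀ X Y → Λ ⊢ X ▷ Y ⊃ (◇ X ⊃ ◇ Y)
J4-from-J2 {Λ} m X Y =
  mpTaut □¬X (tautology (X ▷ Y ∷ □ (¬' Y) ∷ □ (¬' X) ∷ []) (((#0 ∧p #1) ⊃p #2) ⊃p (#0 ⊃p (¬p #2 ⊃p ¬p #1))))
  where
  open Derivations Λ
  c : Fm
  c = X ▷ Y ∧' □ (¬' Y)
  X▷Y : c ⊩ X ▷ Y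
  X▷Y = ⊢taut (tautology (X ▷ Y ∷ □ (¬' Y) ∷ []) ((#0 ∧p #1) ⊃p #0))
  Y▷⊥ : c ⊩ Y ▷ ⊥'
  Y▷⊥ = ⊩□¬▷ (⊢taut (tautology (X ▷ Y ∷ □ (¬' Y) ∷ []) ((#0 ∧p #1) ⊃p #1)))
  X▷⊥ : c ⊩ X ▷ ⊥'
  X▷⊥ = ⊩app (⊩schema m (j2 X Y ⊥')) (⊩taut2 (tautology (X ▷ Y ∷ Y ▷ ⊥' ∷ []) (#0 ⊃p #1 ⊃p (#0 ∧p #1))) X▷Y Y▷⊥)
  □¬X : c ⊩ □ (¬' X)
  □¬X = ⊩j6← (⊩r2 (⊢taut (tautology (X ∷ []) (¬p (¬p #0) ⊃p #0))) X▷⊥)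

J4-derivable : (L : TheLogic) → ∀ X Y → schemata L ⊢ X ▷ Y ⊃ (◇ X ⊃ ◇ Y)
J4-derivable IL⁻J4     X Y = ax (schema (here refl) (j4 X Y))
J4-derivable IL⁻J1J4   X Y = ax (schema (there (here refl)) (j4 X Y))
J4-derivable IL⁻J4J5   X Y = ax (schema (here refl) (j4 X Y))
J4-derivable IL⁻J1J4J5 X Y = ax (schema (there (here refl)) (j4 X Y))
J4-derivable IL⁻J2     X Y = J4-from-J2 (here refl) X Y
J4-derivable IL⁻J2J4+  X Y = J4-from-J2 (here refl) X Y

J2-alone : (L : TheLogic) → J2 ∈ schemata L → (¬ J1 ∈ schemata L) × (¬ J5 ∈ schemata L)
J2-alone IL⁻J4     (here ())
J2-alone IL⁻J4     (there ())
J2-alone IL⁻J1J4   (here ())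
J2-alone IL⁻J1J4   (there (here ()))
J2-alone IL⁻J1J4   (there (there ()))
J2-alone IL⁻J4J5   (here ())
J2-alone IL⁻J4J5   (there (here ()))
J2-alone IL⁻J4J5   (there (there ()))
J2-alone IL⁻J1J4J5 (here ())
J2-alone IL⁻J1J4J5 (there (here ()))
J2-alone IL⁻J1J4J5 (there (there (here ())))
J2-alone IL⁻J1J4J5 (there (there (there ())))
J2-alone IL⁻J2     _ = (λ { (here ()) ; (there ()) }) , (λ { (here ()) ; (there ()) })
J2-alone IL⁻J2J4+  _ = (λ { (here ()) ; (there (here ())) ; (there (there ())) })
                     , (λ { (here ()) ; (there (here ())) ; (there (there ())) })

theorem7p1 : Classical → (L : TheLogic) (A : Fm) →
    ((schemata L ⊢ A) ⇔ (∀ F → LFrame (schemata L) F → ValidIn F A))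
  × ((schemata L ⊢ A) ⇔ (∀ F → Finite F → LFrame (schemata L) F → ValidIn F A))
theorem7p1 classical L A =
    mk⇔ sound (λ valid → complete (λ F _ → valid F))
  , mk⇔ (λ ⊢A F _ → sound ⊢A F) complete
  where
  sound : schemata L ⊢ A → ∀ F → LFrame (schemata L) F → ValidIn F A
  sound ⊢A F lf = Soundness.soundness classical F lf ⊢A
  complete : (∀ F → Finite F → LFrame (schemata L) F → ValidIn F A) → schemata L ⊢ A
  complete = Canonical.completeness (schemata L) classical classical (J4-derivable L) (J2-alone L) A
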